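{- For all $n\geq 2$ and $\sigma\in\{132,231\}$, the number $d_n(\sigma)$ of desarrangements of length $n$ avoiding $\sigma$ equals the Fine number $F_{n+1}$.
   Context: Permutations are in one-line notation. An index $i\in[n-1]$ is a descent of $\pi\in\mathfrak{S}_n$ if $\pi_i>\pi_{i+1}$; $i\in[n]$ is an ascent if it is not a descent (so $n$ is always an ascent). A desarrangement is a permutation whose first ascent is even. $d_n(\Pi)$ is the number of desarrangements in $\mathfrak{S}_n$ avoiding every pattern in $\Pi$ ($\pi$ avoids $\sigma$ if no subsequence of $\pi$ has the same relative order as $\sigma$). The Fine numbers $F_n$ are defined by $\sum_{n\ge0}F_nx^n=\frac{1-\sqrt{1-4x}}{3-\sqrt{1-4x}}$ (so $F_0=0,F_1=1,F_2=0,F_3=1,F_4=2,F_5=6,\dots$). -}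

module Defs where

open import Data.Nat using (ℕ; zero; suc; _<ᵇ_; _≡ᵇ_)
open import Data.Bool using (Bool; true; false; _∧_; _∨_; not; if_then_else_)
open import Data.List using (List; []; _∷_; map; concatMap; filter; length; allFin; foldr)
open import Data.Fin using (Fin; toℕ)
open import Data.Integer using (ℤ; +_; _-_; _*_; _+_)
open import Function using (_∘_)
open import Relation.Nullary.Decidable using (Dec)
open import Data.Bool.Properties using (T?)

-- Permutations of length n in one-line notation: words π = π₁ … πₙ
-- (here as lists of naturals; values are 0-based, which does not affect
-- relative order).

words : ℕ → ℕ → List (List ℕ)
words n zero = [] ∷ []
words n (suc k) = concatMap (λ i → map (toℕ i ∷_) (words n k)) (allFin n)

memberᵇ : ℕ → List ℕ → Bool
memberᵇ x [] = false
memberᵇ x (y ∷ ys) = (x ≡ᵇ y) ∨ memberᵇ x ys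

distinct : List ℕ → Bool
distinct [] = true
distinct (x ∷ xs) = not (memberᵇ x xs) ∧ distinct xs

perms : ℕ → List (List ℕ)
perms n = filter (λ w → T? (distinct w)) (words n n)

-- Position i (1-based) is an
-- ascent iff i = n or π_i < π_{i+1}.  firstAscent i w returns the
-- position of the first ascent of w, where i is the position of the head.
firstAscent : ℕ → List ℕ → ℕ
firstAscent i [] = i
firstAscent i (x ∷ []) = i
firstAscent i (x ∷ y ∷ ys) = if x <ᵇ y then i else firstAscent (suc i) (y ∷ ys)

even : ℕ → Bool
even zero = true
even (suc zero) = false
even (suc (suc n)) = even n

isDesarrangement : List ℕ → Bool
isDesarrangement w = even (firstAscent 1 w)

-- Pattern containment for patterns of length 3: σ = abc (a list of three
-- distinct values) occurs in π if there are positions i<j<k with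
-- (π_i, π_j, π_k) order-isomorphic to σ.
sameOrder : ℕ → ℕ → ℕ → ℕ → Bool
sameOrder a b x y = (a <ᵇ b) ≡ᵇ' (x <ᵇ y)
  where
  _≡ᵇ'_ : Bool → Bool → Bool
  true ≡ᵇ' true = true
  false ≡ᵇ' false = true
  _ ≡ᵇ' _ = false

iso3 : ℕ → ℕ → ℕ → ℕ → ℕ → ℕ → Bool
iso3 a b c x y z = sameOrder a b x y ∧ sameOrder b a y x ∧ sameOrder a c x z
                 ∧ sameOrder c a z x ∧ sameOrder b c y z ∧ sameOrder c b z y

anyᵇ : {A : Set} → (A → Bool) → List A → Bool
anyᵇ p [] = false
anyᵇ p (x ∷ xs) = p x ∨ anyᵇ p xs

subseqs : ℕ → List ℕ → List (List ℕ)
subseqs zero _ = [] ∷ []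
subseqs (suc k) [] = []
subseqs (suc k) (x ∷ xs) = map (x ∷_) (subseqs k xs) ++' subseqs (suc k) xs
  where
  _++'_ : List (List ℕ) → List (List ℕ) → List (List ℕ)
  [] ++' ys = ys
  (z ∷ zs) ++' ys = z ∷ (zs ++' ys)

occurs3 : ℕ → ℕ → ℕ → List ℕ → Bool
occurs3 a b c w = anyᵇ match (subseqs 3 w)
  where
  match : List ℕ → Bool
  match (x ∷ y ∷ z ∷ []) = iso3 a b c x y z
  match _ = false

data Pattern : Set where
  p132 p231 : Pattern

avoids : Pattern → List ℕ → Bool
avoids p132 w = not (occurs3 1 3 2 w)
avoids p231 w = not (occurs3 2 3 1 w)

d : ℕ → Pattern → ℕ
d n σ = length (filter (λ w → T? (isDesarrangement w ∧ avoids σ w)) (perms n))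

-- Fine numbers, defined from the generating function in the paper:
-- with C(x) = Σ C_n xⁿ the Catalan series, √(1-4x) = 1 - 2xC(x), so
--   (1-√(1-4x))/(3-√(1-4x)) = xC/(1+xC),  i.e.  G·(1 + xC) = xC,
-- i.e. F_0 = 0 and for n ≥ 1:  F_n = C_{n-1} - Σ_{k=1}^{n-1} C_{k-1} F_{n-k}.
-- Sequences are computed as lists of their first terms, newest term first.

dot : List ℤ → List ℤ → ℤ
dot (x ∷ xs) (y ∷ ys) = x * y + dot xs ys
dot _ _ = + 0

rev : {A : Set} → List A → List A
rev = foldr (λ x acc → acc ++ᴸ (x ∷ [])) []
  where
  _++ᴸ_ : {A : Set} → List A → List A → List A
  [] ++ᴸ ys = ys
  (z ∷ zs) ++ᴸ ys = z ∷ (zs ++ᴸ ys)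

-- catsRev n = [C_n, C_{n-1}, …, C_0];  C_{n+1} = Σ_{i=0}^{n} C_i C_{n-i}
catsRev : ℕ → List ℤ
catsRev zero = + 1 ∷ []
catsRev (suc n) = dot (catsRev n) (rev (catsRev n)) ∷ catsRev n

headᶻ : List ℤ → ℤ
headᶻ [] = + 0
headᶻ (x ∷ _) = x

catalan : ℕ → ℤ
catalan n = headᶻ (catsRev n)

-- fineRev n = [F_n, F_{n-1}, …, F_0]
-- F_{n+1} = C_n - Σ_{k=1}^{n} C_{k-1} F_{n+1-k}
--         = C_n - dot [C_0, …, C_{n-1}] [F_n, …, F_1]
fineRev : ℕ → List ℤ
fineRev zero = + 0 ∷ []
fineRev (suc n) = (catalan n - dot (rev (dropHead (catsRev n))) (fineRev n)) ∷ fineRev n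
  where
  dropHead : List ℤ → List ℤ
  dropHead [] = []
  dropHead (_ ∷ xs) = xs

fine : ℕ → ℤ
fine n = headᶻ (fineRev n)

{-# OPTIONS --safe #-}
-- Split a σ-avoiding permutation at its maximum: π = u m v. For σ = 132 every letter of u
-- exceeds every letter of v, for σ = 231 every letter of u is smaller, and apart from this π
-- avoids σ exactly when u and v do; so u and v range independently over the avoiders of two
-- complementary intervals. If u is nonempty, m turns the last position of u into an ascent, so
-- π is a desarrangement iff u is; if u is empty, π is one iff v is nonempty with odd first
-- ascent. Writing A k, D k and O k for the numbers of avoiders, desarrangements and nonempty
-- avoiders with odd first ascent, this gives
--   A (m+1) = Σ_{i≤m} A i · A (m−i),   D (m+1) = O m + Σ_{1≤i≤m} D i · A (m−i),
--   A (m+1) = D (m+1) + O (m+1).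
-- Hence A is the Catalan sequence, and D (n+1) = F (n+2) follows by induction, using the
-- Fine-number identity C (n+1) = 2 F (n+2) + F (n+1).

module Submission where

open import Defs
open import Data.List using (List; []; _∷_; _++_; map)
open import Function using (_∘_; id)
open import Relation.Binary.PropositionalEquality

module FineNumbers where
  open import Data.Integer using (ℤ; +_; _+_; _-_; _*_)
  open import Data.Integer.Properties
    using (+-identityʳ; +-identityˡ; +-assoc; +-comm; *-comm; *-identityʳ; *-zeroʳ; *-distribˡ-+; +-inverseʳ)
  open import Data.Integer.Tactic.RingSolver using (solve-∀)
  open import Data.List using (reverse; upTo; downFrom)
  open import Data.List.Properties
    using (reverse-map; reverse-upTo; reverse-involutive; unfold-reverse; map-applyUpTo; map-upTo)
  open import Data.Nat as ℕ using (ℕ; zero; suc; _∸_; _<_; z≤n; s≤s)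
  import Data.Nat.Properties as ℕ
  open import Data.Nat.Induction using (<-rec)

  C F : ℕ → ℤ
  C = catalan
  F = fine

  sumℤ : ℕ → (ℕ → ℤ) → ℤ
  sumℤ zero f = + 0
  sumℤ (suc k) f = f 0 + sumℤ k (f ∘ suc)

  sumℤ-cong : (k : ℕ) {f g : ℕ → ℤ} → (∀ {i} → i < k → f i ≡ g i) → sumℤ k f ≡ sumℤ k g
  sumℤ-cong zero e = refl
  sumℤ-cong (suc k) e = cong₂ _+_ (e (s≤s z≤n)) (sumℤ-cong k (e ∘ s≤s))

  sumℤ-− : (k : ℕ) (f g : ℕ → ℤ) → sumℤ k (λ i → f i - g i) ≡ sumℤ k f - sumℤ k g
  sumℤ-− zero f g = refl
  sumℤ-− (suc k) f g rewrite sumℤ-− k (f ∘ suc) (g ∘ suc) =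
    interchange (f 0) (g 0) (sumℤ k (f ∘ suc)) (sumℤ k (g ∘ suc))
    where
    interchange : ∀ a b c e → (a - b) + (c - e) ≡ (a + c) - (b + e)
    interchange = solve-∀

  sumℤ-*ˡ : (k : ℕ) (c : ℤ) (f : ℕ → ℤ) → sumℤ k (λ i → c * f i) ≡ c * sumℤ k f
  sumℤ-*ˡ zero c f = sym (*-zeroʳ c)
  sumℤ-*ˡ (suc k) c f rewrite sumℤ-*ˡ k c (f ∘ suc) = sym (*-distribˡ-+ c (f 0) _)

  sumℤ-last : (k : ℕ) (f : ℕ → ℤ) → sumℤ (suc k) f ≡ sumℤ k f + f k
  sumℤ-last zero f = trans (+-identityʳ (f 0)) (sym (+-identityˡ (f 0)))
  sumℤ-last (suc k) f rewrite sumℤ-last k (f ∘ suc) = sym (+-assoc (f 0) _ _)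

  sumℤ-reverse : (k : ℕ) (f : ℕ → ℤ) → sumℤ k f ≡ sumℤ k (λ i → f (k ∸ suc i))
  sumℤ-reverse zero f = refl
  sumℤ-reverse (suc k) f = begin
    f 0 + sumℤ k (f ∘ suc)                         ≡⟨ cong (_+_ (f 0)) (sumℤ-reverse k (f ∘ suc)) ⟩
    f 0 + sumℤ k (λ i → f (suc (k ∸ suc i)))       ≡⟨ +-comm (f 0) _ ⟩
    sumℤ k (λ i → f (suc (k ∸ suc i))) + f 0       ≡⟨ cong₂ _+_ (sumℤ-cong k (λ i<k → cong f (sym (ℕ.+-∸-assoc 1 i<k))))
                                                               (cong f (sym (ℕ.n∸n≡0 k))) ⟩
    sumℤ k (λ i → f (suc k ∸ suc i)) + f (k ∸ k)   ≡⟨ sumℤ-last k (λ i → f (k ∸ i)) ⟨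
    sumℤ (suc k) (λ i → f (k ∸ i))                 ∎
    where open ≡-Reasoning

  catsRev≡ : (n : ℕ) → catsRev n ≡ map C (downFrom (suc n))
  catsRev≡ zero = refl
  catsRev≡ (suc n) = cong (C (suc n) ∷_) (catsRev≡ n)

  fineRev≡ : (n : ℕ) → fineRev n ≡ map F (downFrom (suc n))
  fineRev≡ zero = refl
  fineRev≡ (suc n) = cong (F (suc n) ∷_) (fineRev≡ n)

  -- rev in Defs appends with a where-bound copy of _++_, which cannot be referred to by name;
  -- the with-abstraction below lets unification solve revAppend to it.
  mutual
    revAppend : List ℤ → List ℤ → List ℤ
    revAppend = _

    rev-∷ : (x : ℤ) (xs : List ℤ) → rev (x ∷ xs) ≡ revAppend (rev xs) (x ∷ [])
    rev-∷ x xs with rev xs | List._∷_ x []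
    ... | ys | zs = refl

  revAppend≡++ : (ys zs : List ℤ) → revAppend ys zs ≡ ys ++ zs
  revAppend≡++ [] zs = refl
  revAppend≡++ (y ∷ ys) zs = cong (y ∷_) (revAppend≡++ ys zs)

  rev≡reverse : (xs : List ℤ) → rev xs ≡ reverse xs
  rev≡reverse [] = refl
  rev≡reverse (x ∷ xs) = begin
    rev (x ∷ xs)                ≡⟨ rev-∷ x xs ⟩
    revAppend (rev xs) (x ∷ []) ≡⟨ revAppend≡++ (rev xs) (x ∷ []) ⟩
    rev xs ++ x ∷ []            ≡⟨ cong (_++ x ∷ []) (rev≡reverse xs) ⟩
    reverse xs ++ x ∷ []        ≡⟨ unfold-reverse x xs ⟨
    reverse (x ∷ xs)            ∎
    where open ≡-Reasoning

  rev-map-downFrom : (f : ℕ → ℤ) (n : ℕ) → rev (map f (downFrom n)) ≡ map f (upTo n)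
  rev-map-downFrom f n = begin
    rev (map f (downFrom n))           ≡⟨ rev≡reverse (map f (downFrom n)) ⟩
    reverse (map f (downFrom n))       ≡⟨ reverse-map f (downFrom n) ⟨
    map f (reverse (downFrom n))       ≡⟨ cong (map f ∘ reverse) (reverse-upTo n) ⟨
    map f (reverse (reverse (upTo n))) ≡⟨ cong (map f) (reverse-involutive (upTo n)) ⟩
    map f (upTo n)                     ∎
    where open ≡-Reasoning

  map-upTo-suc : (g : ℕ → ℤ) (n : ℕ) → map g (upTo (suc n)) ≡ g 0 ∷ map (g ∘ suc) (upTo n)
  map-upTo-suc g n = cong (g 0 ∷_) (trans (map-applyUpTo suc g n) (sym (map-upTo (g ∘ suc) n)))

  dot-upTo-downFrom : (g f : ℕ → ℤ) (k : ℕ) →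
    dot (map g (upTo (suc k))) (map f (downFrom (suc k))) ≡ sumℤ (suc k) (λ i → g i * f (k ∸ i))
  dot-upTo-downFrom g f zero = refl
  dot-upTo-downFrom g f (suc k) =
    trans (cong (λ xs → dot xs (map f (downFrom (suc (suc k))))) (map-upTo-suc g (suc k)))
          (cong (_+_ (g 0 * f (suc k))) (dot-upTo-downFrom (g ∘ suc) f k))

  dot-upTo-downFrom-suc : (g f : ℕ → ℤ) (k : ℕ) →
    dot (map g (upTo (suc k))) (map f (downFrom (suc (suc k)))) ≡ sumℤ (suc k) (λ i → g i * f (suc k ∸ i))
  dot-upTo-downFrom-suc g f zero = refl
  dot-upTo-downFrom-suc g f (suc k) =
    trans (cong (λ xs → dot xs (map f (downFrom (suc (suc (suc k)))))) (map-upTo-suc g (suc k)))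
          (cong (_+_ (g 0 * f (suc (suc k)))) (dot-upTo-downFrom-suc (g ∘ suc) f k))

  dot-comm : (xs ys : List ℤ) → dot xs ys ≡ dot ys xs
  dot-comm [] [] = refl
  dot-comm [] (y ∷ ys) = refl
  dot-comm (x ∷ xs) [] = refl
  dot-comm (x ∷ xs) (y ∷ ys) = cong₂ _+_ (*-comm x y) (dot-comm xs ys)

  catalan-suc : (n : ℕ) → C (suc n) ≡ sumℤ (suc n) (λ i → C i * C (n ∸ i))
  catalan-suc n = begin
    dot (catsRev n) (rev (catsRev n))                                ≡⟨ cong (λ xs → dot xs (rev xs)) (catsRev≡ n) ⟩
    dot (map C (downFrom (suc n))) (rev (map C (downFrom (suc n))))  ≡⟨ cong (dot _) (rev-map-downFrom C (suc n)) ⟩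
    dot (map C (downFrom (suc n))) (map C (upTo (suc n)))            ≡⟨ dot-comm (map C (downFrom (suc n))) _ ⟩
    dot (map C (upTo (suc n))) (map C (downFrom (suc n)))            ≡⟨ dot-upTo-downFrom C C n ⟩
    sumℤ (suc n) (λ i → C i * C (n ∸ i))                             ∎
    where open ≡-Reasoning

  fine-suc : (n : ℕ) → F (suc n) ≡ C n - sumℤ n (λ i → C i * F (n ∸ i))
  fine-suc zero = refl
  fine-suc (suc n) = cong (_-_ (C (suc n))) (begin
    dot (rev (catsRev n)) (fineRev (suc n))
      ≡⟨ cong₂ dot (trans (cong rev (catsRev≡ n)) (rev-map-downFrom C (suc n))) (fineRev≡ (suc n)) ⟩
    dot (map C (upTo (suc n))) (map F (downFrom (suc (suc n))))
      ≡⟨ dot-upTo-downFrom-suc C F n ⟩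
    sumℤ (suc n) (λ i → C i * F (suc n ∸ i)) ∎)
    where open ≡-Reasoning

  catalan-suc-last : (k : ℕ) → C (suc k) ≡ sumℤ k (λ i → C i * C (k ∸ i)) + C k
  catalan-suc-last k =
    trans (catalan-suc k) (trans (sumℤ-last k _) (cong (_+_ (sumℤ k (λ i → C i * C (k ∸ i)))) last-term))
    where
    last-term : C k * C (k ∸ k) ≡ C k
    last-term = trans (cong (λ j → C k * C j) (ℕ.n∸n≡0 k)) (*-identityʳ (C k))

  fine-suc-suc : (k : ℕ) → F (suc (suc k)) ≡ C (suc k) - (sumℤ k (λ i → C i * F (suc k ∸ i)) + C k)
  fine-suc-suc k =
    trans (fine-suc (suc k))
          (cong (_-_ (C (suc k))) (trans (sumℤ-last k _) (cong (_+_ (sumℤ k (λ i → C i * F (suc k ∸ i)))) last-term)))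
    where
    last-term : C k * F (suc k ∸ k) ≡ C k
    last-term = trans (cong (λ j → C k * F j) (ℕ.m+n∸n≡m 1 k)) (*-identityʳ (C k))

  CatalanFine : ℕ → Set
  CatalanFine n = C (suc n) ≡ + 2 * F (suc (suc n)) + F (suc n)

  twice-sum-catalan-fine : (k : ℕ) → (∀ {j} → j < k → CatalanFine j) →
    + 2 * sumℤ k (λ i → C i * F (suc k ∸ i)) ≡ sumℤ k (λ i → C i * C (k ∸ i)) - sumℤ k (λ i → C i * F (k ∸ i))
  twice-sum-catalan-fine k IH = begin
    + 2 * sumℤ k (λ i → C i * F (suc k ∸ i))                   ≡⟨ sumℤ-*ˡ k (+ 2) _ ⟨
    sumℤ k (λ i → + 2 * (C i * F (suc k ∸ i)))                 ≡⟨ sumℤ-cong k term ⟩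
    sumℤ k (λ i → C i * C (k ∸ i) - C i * F (k ∸ i))           ≡⟨ sumℤ-− k _ _ ⟩
    sumℤ k (λ i → C i * C (k ∸ i)) - sumℤ k (λ i → C i * F (k ∸ i)) ∎
    where
    open ≡-Reasoning
    ∸-suc-< : ∀ {i k} → i < k → k ∸ suc i < k
    ∸-suc-< {i} {suc k} _ = s≤s (ℕ.m∸n≤m k i)
    distribute : ∀ c f₂ f₁ → + 2 * (c * f₂) ≡ c * (+ 2 * f₂ + f₁) - c * f₁
    distribute = solve-∀
    term : ∀ {i} → i < k → + 2 * (C i * F (suc k ∸ i)) ≡ C i * C (k ∸ i) - C i * F (k ∸ i)
    term {i} i<k rewrite ℕ.+-∸-assoc 1 (ℕ.<⇒≤ i<k) | ℕ.+-∸-assoc 1 i<k =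
      trans (distribute (C i) (F (suc (suc (k ∸ suc i)))) (F (suc (k ∸ suc i))))
            (cong (λ c → C i * c - C i * F (suc (k ∸ suc i))) (sym (IH (∸-suc-< i<k))))

  cancel-difference : (x : ℤ) {p q : ℤ} → p ≡ q → x + (p - q) ≡ x
  cancel-difference x {p} refl = trans (cong (_+_ x) (+-inverseʳ p)) (+-identityʳ x)

  catalan-fine : (n : ℕ) → CatalanFine n
  catalan-fine = <-rec CatalanFine step
    where
    step : ∀ n → (∀ {j} → j < n → CatalanFine j) → CatalanFine n
    step n IH = begin
      C (suc n)                                         ≡⟨ catalan-suc-last n ⟩
      A + C n                                           ≡⟨ cancel-difference (A + C n) (sym (twice-sum-catalan-fine n IH)) ⟨
      (A + C n) + ((A - B) - + 2 * S)                   ≡⟨ rearrange A B S (C n) ⟩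
      + 2 * ((A + C n) - (S + C n)) + (C n - B)         ≡⟨ cong₂ (λ c f → + 2 * (c - (S + C n)) + f)
                                                                 (catalan-suc-last n) (fine-suc n) ⟨
      + 2 * (C (suc n) - (S + C n)) + F (suc n)         ≡⟨ cong (λ f → + 2 * f + F (suc n)) (fine-suc-suc n) ⟨
      + 2 * F (suc (suc n)) + F (suc n)                 ∎
      where
      open ≡-Reasoning
      A B S : ℤ
      A = sumℤ n (λ i → C i * C (n ∸ i))
      B = sumℤ n (λ i → C i * F (n ∸ i))
      S = sumℤ n (λ i → C i * F (suc n ∸ i))
      rearrange : ∀ a b s c → (a + c) + ((a - b) - + 2 * s) ≡ + 2 * ((a + c) - (s + c)) + (c - b)
      rearrange = solve-∀

  fine-desarrangement-recurrence : (m : ℕ) →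
    F (3 ℕ.+ m) ≡ (C (suc m) - F (2 ℕ.+ m)) + sumℤ (suc m) (λ i → F (2 ℕ.+ i) * C (m ∸ i))
  fine-desarrangement-recurrence m = begin
    F (suc (suc k))                                     ≡⟨ fine-suc-suc k ⟩
    C (suc k) - (S + C k)                               ≡⟨ cong (λ c → c - (S + C k)) (catalan-suc-last k) ⟩
    (A + C k) - (S + C k)                               ≡⟨ rearrange A B S (C k) ⟩
    ((C k - (C k - B)) + S) + ((A - B) - + 2 * S)       ≡⟨ cancel-difference _ (sym (twice-sum-catalan-fine k
                                                             (λ {j} _ → catalan-fine j))) ⟩
    (C k - (C k - B)) + S                               ≡⟨ cong₂ (λ f t → (C k - f) + t) (fine-suc k) reflect ⟨
    (C k - F (suc k)) + sumℤ k (λ i → F (2 ℕ.+ i) * C (m ∸ i)) ∎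
    where
    open ≡-Reasoning
    k : ℕ
    k = suc m
    A B S : ℤ
    A = sumℤ k (λ i → C i * C (k ∸ i))
    B = sumℤ k (λ i → C i * F (k ∸ i))
    S = sumℤ k (λ i → C i * F (suc k ∸ i))
    rearrange : ∀ a b s c → (a + c) - (s + c) ≡ ((c - (c - b)) + s) + ((a - b) - + 2 * s)
    rearrange = solve-∀
    term : ∀ {i} → i < k → F (2 ℕ.+ (m ∸ i)) * C (m ∸ (m ∸ i)) ≡ C i * F (suc k ∸ i)
    term {i} (s≤s i≤m) rewrite ℕ.m∸[m∸n]≡n i≤m | ℕ.+-∸-assoc 2 i≤m = *-comm (F (2 ℕ.+ (m ∸ i))) (C i)
    reflect : sumℤ k (λ i → F (2 ℕ.+ i) * C (m ∸ i)) ≡ S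
    reflect = trans (sumℤ-reverse k (λ i → F (2 ℕ.+ i) * C (m ∸ i))) (sumℤ-cong k term)

open import Algebra.Bundles using (CommutativeMonoid)
open import Data.Bool using (Bool; true; false; _∧_; _∨_; not; T)
open import Data.Bool.ListAction using (all)
open import Data.Bool.Properties
  using (∧-assoc; ∧-zeroʳ; ∧-identityʳ; ∨-assoc; ∨-zeroʳ; not-involutive; not-injective; T?; ∧-commutativeMonoid)
open import Data.Empty using (⊥-elim)
open import Data.Fin using (toℕ)
open import Data.List using (length; concatMap; take; drop; filter; filterᵇ; tabulate; allFin)
open import Data.List.Membership.Propositional using (_∈_; _∉_)
open import Data.List.Properties using (map-tabulate; concatMap-map; length-filter; filter-++; ++-identityʳ; length-take)
open import Data.List.Relation.Unary.All using (All; []; _∷_; lookup)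
import Data.List.Relation.Unary.All as All
open import Data.List.Relation.Unary.All.Properties using (take⁺; drop⁺)
open import Data.List.Relation.Unary.Any using (here; there)
open import Data.Nat using (ℕ; zero; suc; _+_; _*_; _∸_; _≤_; _<_; _≥_; z≤n; s≤s; _≡ᵇ_; _<ᵇ_)
open import Data.Nat.Induction using (<-rec)
open import Data.Nat.Properties
open import Data.Product using (_×_; _,_; proj₁; proj₂; map₁)
open import Data.Sum using (inj₁; inj₂)
open import Algebra.Properties.CommutativeSemigroup +-commutativeSemigroup using (interchange)
open import Algebra.Properties.CommutativeSemigroup (CommutativeMonoid.commutativeSemigroup ∧-commutativeMonoid)
  using () renaming (x∙yz≈y∙xz to ∧-left-comm)

-- Finite sums

ind : Bool → ℕ
ind true = 1
ind false = 0

sumBy : {A : Set} → (A → ℕ) → List A → ℕ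
sumBy f [] = 0
sumBy f (x ∷ xs) = f x + sumBy f xs

count : {A : Set} → (A → Bool) → List A → ℕ
count p = sumBy (ind ∘ p)

sumBy-++ : {A : Set} (f : A → ℕ) (xs ys : List A) → sumBy f (xs ++ ys) ≡ sumBy f xs + sumBy f ys
sumBy-++ f [] ys = refl
sumBy-++ f (x ∷ xs) ys = trans (cong (f x +_) (sumBy-++ f xs ys)) (sym (+-assoc (f x) _ _))

sumBy-map : {A B : Set} (f : B → ℕ) (g : A → B) (xs : List A) → sumBy f (map g xs) ≡ sumBy (f ∘ g) xs
sumBy-map f g [] = refl
sumBy-map f g (x ∷ xs) = cong (f (g x) +_) (sumBy-map f g xs)

sumBy-concatMap : {A B : Set} (f : B → ℕ) (g : A → List B) (xs : List A) →
  sumBy f (concatMap g xs) ≡ sumBy (sumBy f ∘ g) xs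
sumBy-concatMap f g [] = refl
sumBy-concatMap f g (x ∷ xs) =
  trans (sumBy-++ f (g x) (concatMap g xs)) (cong (sumBy f (g x) +_) (sumBy-concatMap f g xs))

sumBy-cong : {A : Set} {f g : A → ℕ} (xs : List A) → (∀ {x} → x ∈ xs → f x ≡ g x) → sumBy f xs ≡ sumBy g xs
sumBy-cong [] h = refl
sumBy-cong (x ∷ xs) h = cong₂ _+_ (h (here refl)) (sumBy-cong xs (h ∘ there))

sumBy-zero : {A : Set} {f : A → ℕ} (xs : List A) → (∀ {x} → x ∈ xs → f x ≡ 0) → sumBy f xs ≡ 0
sumBy-zero [] h = refl
sumBy-zero (x ∷ xs) h = cong₂ _+_ (h (here refl)) (sumBy-zero xs (h ∘ there))

sumBy-+ : {A : Set} (f g : A → ℕ) (xs : List A) → sumBy (λ x → f x + g x) xs ≡ sumBy f xs + sumBy g xs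
sumBy-+ f g [] = refl
sumBy-+ f g (x ∷ xs) = trans (cong (f x + g x +_) (sumBy-+ f g xs)) (interchange (f x) (g x) _ _)

sumBy-*ʳ : {A : Set} (f : A → ℕ) (c : ℕ) (xs : List A) → sumBy (λ x → f x * c) xs ≡ sumBy f xs * c
sumBy-*ʳ f c [] = refl
sumBy-*ʳ f c (x ∷ xs) = trans (cong (f x * c +_) (sumBy-*ʳ f c xs)) (sym (*-distribʳ-+ c (f x) (sumBy f xs)))

count-false : {A : Set} (xs : List A) → count (λ _ → false) xs ≡ 0
count-false [] = refl
count-false (x ∷ xs) = count-false xs

ind-∧ : (a b : Bool) → ind (a ∧ b) ≡ ind a * ind b
ind-∧ true b = sym (+-identityʳ (ind b))
ind-∧ false b = refl

sumBelow : ℕ → (ℕ → ℕ) → ℕ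
sumBelow zero g = 0
sumBelow (suc k) g = g 0 + sumBelow k (g ∘ suc)

sumBelow-cong : (k : ℕ) {g h : ℕ → ℕ} → (∀ {i} → i < k → g i ≡ h i) → sumBelow k g ≡ sumBelow k h
sumBelow-cong zero e = refl
sumBelow-cong (suc k) e = cong₂ _+_ (e (s≤s z≤n)) (sumBelow-cong k (e ∘ s≤s))

sumBelow-zero : (k : ℕ) → sumBelow k (λ _ → 0) ≡ 0
sumBelow-zero zero = refl
sumBelow-zero (suc k) = sumBelow-zero k

sumBelow-+ : (k : ℕ) (g h : ℕ → ℕ) → sumBelow k (λ i → g i + h i) ≡ sumBelow k g + sumBelow k h
sumBelow-+ zero g h = refl
sumBelow-+ (suc k) g h = trans (cong (g 0 + h 0 +_) (sumBelow-+ k (g ∘ suc) (h ∘ suc))) (interchange (g 0) (h 0) _ _)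

sumBelow-*ʳ : (k : ℕ) (g : ℕ → ℕ) (c : ℕ) → sumBelow k (λ i → g i * c) ≡ sumBelow k g * c
sumBelow-*ʳ zero g c = refl
sumBelow-*ʳ (suc k) g c = trans (cong (g 0 * c +_) (sumBelow-*ʳ k (g ∘ suc) c)) (sym (*-distribʳ-+ c (g 0) _))

sumBy-sumBelow : {A : Set} (k : ℕ) (g : ℕ → A → ℕ) (xs : List A) →
  sumBy (λ x → sumBelow k (λ i → g i x)) xs ≡ sumBelow k (λ i → sumBy (g i) xs)
sumBy-sumBelow k g [] = sym (sumBelow-zero k)
sumBy-sumBelow k g (x ∷ xs) =
  trans (cong (sumBelow k (λ i → g i x) +_) (sumBy-sumBelow k g xs)) (sym (sumBelow-+ k (λ i → g i x) (λ i → sumBy (g i) xs)))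

-- Boolean membership and duplicate-free lists

true≢false : true ≢ false
true≢false ()

∧-true : {a b : Bool} → (a ∧ b) ≡ true → a ≡ true × b ≡ true
∧-true {true} {true} _ = refl , refl

≡ᵇ-refl : (n : ℕ) → (n ≡ᵇ n) ≡ true
≡ᵇ-refl zero = refl
≡ᵇ-refl (suc n) = ≡ᵇ-refl n

≡ᵇ-sound : (m n : ℕ) → (m ≡ᵇ n) ≡ true → m ≡ n
≡ᵇ-sound m n e = ≡ᵇ⇒≡ m n (subst T (sym e) _)

≢⇒≡ᵇ-false : (m n : ℕ) → m ≢ n → (m ≡ᵇ n) ≡ false
≢⇒≡ᵇ-false m n m≢n with m ≡ᵇ n in e
... | true = ⊥-elim (m≢n (≡ᵇ-sound m n e))
... | false = refl

<ᵇ-sound : (m n : ℕ) → (m <ᵇ n) ≡ true → m < n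
<ᵇ-sound m n e = <ᵇ⇒< m n (subst T (sym e) _)

<ᵇ-true : {m n : ℕ} → m < n → (m <ᵇ n) ≡ true
<ᵇ-true {m} {n} m<n with m <ᵇ n | <⇒<ᵇ m<n
... | true | _ = refl

<ᵇ-false : {m n : ℕ} → n ≤ m → (m <ᵇ n) ≡ false
<ᵇ-false {m} {n} n≤m with m <ᵇ n in e
... | false = refl
... | true = ⊥-elim (<⇒≱ (<ᵇ-sound m n e) n≤m)

memberᵇ-complete : {x : ℕ} {xs : List ℕ} → x ∈ xs → memberᵇ x xs ≡ true
memberᵇ-complete {x} (here refl) rewrite ≡ᵇ-refl x = refl
memberᵇ-complete {x} {y ∷ xs} (there x∈xs) rewrite memberᵇ-complete x∈xs = ∨-zeroʳ (x ≡ᵇ y)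

memberᵇ-sound : {x : ℕ} (xs : List ℕ) → memberᵇ x xs ≡ true → x ∈ xs
memberᵇ-sound {x} (y ∷ xs) e with x ≡ᵇ y in x≡y
... | true = here (≡ᵇ-sound x y x≡y)
... | false = there (memberᵇ-sound xs e)

memberᵇ-false : {x : ℕ} {xs : List ℕ} → x ∉ xs → memberᵇ x xs ≡ false
memberᵇ-false {x} {xs} x∉xs with memberᵇ x xs in e
... | true = ⊥-elim (x∉xs (memberᵇ-sound xs e))
... | false = refl

distinct-∷ : (x : ℕ) (xs : List ℕ) → distinct (x ∷ xs) ≡ true → x ∉ xs × distinct xs ≡ true
distinct-∷ x xs d with memberᵇ x xs in e | distinct xs
... | false | true = (λ x∈xs → true≢false (trans (sym (memberᵇ-complete x∈xs)) e)) , refl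

distinct-∷⁺ : {x : ℕ} {xs : List ℕ} → x ∉ xs → distinct xs ≡ true → distinct (x ∷ xs) ≡ true
distinct-∷⁺ x∉xs d rewrite memberᵇ-false x∉xs = d

sumBy-unique : {f : ℕ → ℕ} {M : ℕ} (A : List ℕ) → distinct A ≡ true → M ∈ A →
  (∀ {b} → b ∈ A → b ≢ M → f b ≡ 0) → sumBy f A ≡ f M
sumBy-unique {f} (x ∷ A) d (here refl) others =
  trans (cong (f x +_) (sumBy-zero A (λ b∈A → others (there b∈A) λ { refl → proj₁ (distinct-∷ x A d) b∈A })))
        (+-identityʳ (f x))
sumBy-unique (x ∷ A) d (there M∈A) others =
  cong₂ _+_ (others (here refl) λ { refl → proj₁ (distinct-∷ x A d) M∈A })
            (sumBy-unique A (proj₂ (distinct-∷ x A d)) M∈A (others ∘ there))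

∈-filterᵇ⁻ : (p : ℕ → Bool) {x : ℕ} (xs : List ℕ) → x ∈ filterᵇ p xs → x ∈ xs × p x ≡ true
∈-filterᵇ⁻ p (y ∷ xs) x∈ with p y in py
∈-filterᵇ⁻ p (y ∷ xs) (here refl) | true = here refl , py
∈-filterᵇ⁻ p (y ∷ xs) (there x∈) | true = map₁ there (∈-filterᵇ⁻ p xs x∈)
... | false = map₁ there (∈-filterᵇ⁻ p xs x∈)

∈-filterᵇ⁺ : (p : ℕ → Bool) {x : ℕ} {xs : List ℕ} → x ∈ xs → p x ≡ true → x ∈ filterᵇ p xs
∈-filterᵇ⁺ p (here refl) px rewrite px = here refl
∈-filterᵇ⁺ p {xs = y ∷ xs} (there x∈) px with p y
... | true = there (∈-filterᵇ⁺ p x∈ px)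
... | false = ∈-filterᵇ⁺ p x∈ px

filterᵇ-all : (p : ℕ → Bool) (xs : List ℕ) → (∀ {x} → x ∈ xs → p x ≡ true) → filterᵇ p xs ≡ xs
filterᵇ-all p [] h = refl
filterᵇ-all p (x ∷ xs) h rewrite h (here refl) = cong (x ∷_) (filterᵇ-all p xs (h ∘ there))

filterᵇ-none : (p : ℕ → Bool) (xs : List ℕ) → (∀ {x} → x ∈ xs → p x ≡ false) → filterᵇ p xs ≡ []
filterᵇ-none p [] h = refl
filterᵇ-none p (x ∷ xs) h rewrite h (here refl) = filterᵇ-none p xs (h ∘ there)

filterᵇ-cong : {p q : ℕ → Bool} (xs : List ℕ) → (∀ x → p x ≡ q x) → filterᵇ p xs ≡ filterᵇ q xs
filterᵇ-cong [] h = refl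
filterᵇ-cong {p} {q} (x ∷ xs) h rewrite h x with q x
... | true = cong (x ∷_) (filterᵇ-cong xs h)
... | false = filterᵇ-cong xs h

filterᵇ-comm : (p q : ℕ → Bool) (xs : List ℕ) → filterᵇ p (filterᵇ q xs) ≡ filterᵇ q (filterᵇ p xs)
filterᵇ-comm p q [] = refl
filterᵇ-comm p q (x ∷ xs) with q x in qx | p x in px
... | true | true rewrite qx | px = cong (x ∷_) (filterᵇ-comm p q xs)
... | true | false rewrite px = filterᵇ-comm p q xs
... | false | true rewrite qx = filterᵇ-comm p q xs
... | false | false = filterᵇ-comm p q xs

filterᵇ-++ : (p : ℕ → Bool) (xs ys : List ℕ) → filterᵇ p (xs ++ ys) ≡ filterᵇ p xs ++ filterᵇ p ys
filterᵇ-++ p = filter-++ (T? ∘ p)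

length-filterᵇ-mono : (p q : ℕ → Bool) (xs : List ℕ) → (∀ {x} → x ∈ xs → p x ≡ true → q x ≡ true) →
  length (filterᵇ p xs) ≤ length (filterᵇ q xs)
length-filterᵇ-mono p q [] h = z≤n
length-filterᵇ-mono p q (x ∷ xs) h with p x in px | q x in qx
... | true | true = s≤s (length-filterᵇ-mono p q xs (h ∘ there))
... | true | false = ⊥-elim (true≢false (trans (sym (h (here refl) px)) qx))
... | false | true = m≤n⇒m≤1+n (length-filterᵇ-mono p q xs (h ∘ there))
... | false | false = length-filterᵇ-mono p q xs (h ∘ there)

length-filterᵇ≡0 : (p : ℕ → Bool) {x : ℕ} (xs : List ℕ) → length (filterᵇ p xs) ≡ 0 → x ∈ xs → p x ≡ false
length-filterᵇ≡0 p {x} xs len x∈xs with p x in px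
... | false = refl
... | true with filterᵇ p xs | ∈-filterᵇ⁺ p x∈xs px
length-filterᵇ≡0 p {x} xs () x∈xs | true | _ ∷ _ | _

distinct-filterᵇ : (p : ℕ → Bool) (xs : List ℕ) → distinct xs ≡ true → distinct (filterᵇ p xs) ≡ true
distinct-filterᵇ p [] d = refl
distinct-filterᵇ p (x ∷ xs) d with distinct-∷ x xs d | p x
... | x∉xs , d′ | true = distinct-∷⁺ (x∉xs ∘ proj₁ ∘ ∈-filterᵇ⁻ p xs) (distinct-filterᵇ p xs d′)
... | x∉xs , d′ | false = distinct-filterᵇ p xs d′

sumBy-filterᵇ : (p : ℕ → Bool) (xs : List ℕ) {f : ℕ → ℕ} → (∀ {x} → x ∈ xs → p x ≡ false → f x ≡ 0) →
  sumBy f xs ≡ sumBy f (filterᵇ p xs)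
sumBy-filterᵇ p [] h = refl
sumBy-filterᵇ p (x ∷ xs) {f} h with p x in px
... | true = cong (f x +_) (sumBy-filterᵇ p xs (h ∘ there))
... | false = trans (cong (_+ sumBy f xs) (h (here refl) px)) (sumBy-filterᵇ p xs (h ∘ there))

remove : ℕ → List ℕ → List ℕ
remove b = filterᵇ (λ y → not (b ≡ᵇ y))

∈-remove⁻ : (b : ℕ) {x : ℕ} (xs : List ℕ) → x ∈ remove b xs → x ∈ xs × x ≢ b
∈-remove⁻ b {x} xs x∈ with ∈-filterᵇ⁻ _ xs x∈
... | x∈xs , b≢x = x∈xs , λ { refl → true≢false (trans (sym (≡ᵇ-refl x)) (not-injective b≢x)) }

∈-remove⁺ : {b x : ℕ} {xs : List ℕ} → x ∈ xs → x ≢ b → x ∈ remove b xs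
∈-remove⁺ {b} {x} x∈xs x≢b = ∈-filterᵇ⁺ _ x∈xs (cong not (≢⇒≡ᵇ-false b x (x≢b ∘ sym)))

∉-remove : (b : ℕ) (xs : List ℕ) → b ∉ remove b xs
∉-remove b xs b∈ = proj₂ (∈-remove⁻ b xs b∈) refl

remove-∉ : {b : ℕ} (xs : List ℕ) → b ∉ xs → remove b xs ≡ xs
remove-∉ {b} xs b∉xs =
  filterᵇ-all (λ y → not (b ≡ᵇ y)) xs (λ {x} x∈xs → cong not (≢⇒≡ᵇ-false b x λ { refl → b∉xs x∈xs }))

length-remove : {b : ℕ} (xs : List ℕ) → b ∈ xs → length (remove b xs) < length xs
length-remove {b} (x ∷ xs) (here refl) rewrite ≡ᵇ-refl b = s≤s (length-filter _ xs)
length-remove {b} (x ∷ xs) (there b∈xs) with b ≡ᵇ x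
... | true = m≤n⇒m≤1+n (length-remove xs b∈xs)
... | false = s≤s (length-remove xs b∈xs)

length-remove-distinct : {b : ℕ} (xs : List ℕ) → distinct xs ≡ true → b ∈ xs → suc (length (remove b xs)) ≡ length xs
length-remove-distinct {b} (x ∷ xs) d (here refl) rewrite ≡ᵇ-refl b =
  cong (suc ∘ length) (remove-∉ xs (proj₁ (distinct-∷ x xs d)))
length-remove-distinct {b} (x ∷ xs) d (there b∈xs) with b ≡ᵇ x in b≡x
... | true = ⊥-elim (proj₁ (distinct-∷ x xs d) (subst (_∈ xs) (≡ᵇ-sound b x b≡x) b∈xs))
... | false = cong suc (length-remove-distinct xs (proj₂ (distinct-∷ x xs d)) b∈xs)

notMemberᵇ≡all : (b : ℕ) (w : List ℕ) → not (memberᵇ b w) ≡ all (λ y → not (b ≡ᵇ y)) w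
notMemberᵇ≡all b [] = refl
notMemberᵇ≡all b (y ∷ w) with b ≡ᵇ y
... | true = refl
... | false = notMemberᵇ≡all b w

-- Counting arrangements

wordsOver : List ℕ → ℕ → List (List ℕ)
wordsOver A zero = [] ∷ []
wordsOver A (suc k) = concatMap (λ x → map (x ∷_) (wordsOver A k)) A

arrangements : List ℕ → ℕ → (List ℕ → Bool) → ℕ
arrangements A k P = count (λ w → distinct w ∧ P w) (wordsOver A k)

sumBy-wordsOver-suc : (A : List ℕ) (k : ℕ) (f : List ℕ → ℕ) →
  sumBy f (wordsOver A (suc k)) ≡ sumBy (λ x → sumBy (f ∘ (x ∷_)) (wordsOver A k)) A
sumBy-wordsOver-suc A k f =
  trans (sumBy-concatMap f _ A) (sumBy-cong A (λ {x} _ → sumBy-map f (x ∷_) (wordsOver A k)))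

sumBy-wordsOver-cong : (A : List ℕ) (k : ℕ) {f g : List ℕ → ℕ} →
  (∀ w → length w ≡ k → All (_∈ A) w → f w ≡ g w) → sumBy f (wordsOver A k) ≡ sumBy g (wordsOver A k)
sumBy-wordsOver-cong A zero h = cong (_+ 0) (h [] refl [])
sumBy-wordsOver-cong A (suc k) {f} {g} h = begin
  sumBy f (wordsOver A (suc k))                           ≡⟨ sumBy-wordsOver-suc A k f ⟩
  sumBy (λ x → sumBy (f ∘ (x ∷_)) (wordsOver A k)) A     ≡⟨ sumBy-cong A (λ x∈A → sumBy-wordsOver-cong A k
                                                               (λ w len w⊆A → h _ (cong suc len) (x∈A ∷ w⊆A))) ⟩
  sumBy (λ x → sumBy (g ∘ (x ∷_)) (wordsOver A k)) A     ≡⟨ sym (sumBy-wordsOver-suc A k g) ⟩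
  sumBy g (wordsOver A (suc k))                           ∎
  where open ≡-Reasoning

arrangements-cong : (A : List ℕ) (k : ℕ) {P Q : List ℕ → Bool} →
  (∀ w → length w ≡ k → All (_∈ A) w → distinct w ≡ true → P w ≡ Q w) → arrangements A k P ≡ arrangements A k Q
arrangements-cong A k {P} {Q} h = sumBy-wordsOver-cong A k pointwise
  where
  pointwise : ∀ w → length w ≡ k → All (_∈ A) w → ind (distinct w ∧ P w) ≡ ind (distinct w ∧ Q w)
  pointwise w len w⊆A with distinct w in d
  ... | true = cong ind (h w len w⊆A d)
  ... | false = refl

arrangements-none : (A : List ℕ) (k : ℕ) {P : List ℕ → Bool} →
  (∀ w → length w ≡ k → All (_∈ A) w → distinct w ≡ true → P w ≡ false) → arrangements A k P ≡ 0
arrangements-none A k {P} h = trans (arrangements-cong A k h) (trans (sumBy-wordsOver-cong A k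
  (λ w _ _ → cong ind (∧-zeroʳ (distinct w)))) (count-false (wordsOver A k)))

arrangements-const : (A : List ℕ) (k : ℕ) (c : Bool) (P : List ℕ → Bool) →
  arrangements A k (λ w → c ∧ P w) ≡ ind c * arrangements A k P
arrangements-const A k true P = sym (+-identityʳ _)
arrangements-const A k false P = arrangements-none A k (λ _ _ _ _ → refl)

arrangements-split : (A : List ℕ) (k : ℕ) (q P : List ℕ → Bool) →
  arrangements A k P ≡ arrangements A k (λ w → q w ∧ P w) + arrangements A k (λ w → not (q w) ∧ P w)
arrangements-split A k q P = trans (sumBy-wordsOver-cong A k (λ w _ _ → pointwise (distinct w) (q w) (P w)))
                                   (sumBy-+ _ _ (wordsOver A k))
  where
  pointwise : ∀ d b p → ind (d ∧ p) ≡ ind (d ∧ (b ∧ p)) + ind (d ∧ (not b ∧ p))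
  pointwise false b p = refl
  pointwise true true p = sym (+-identityʳ (ind p))
  pointwise true false p = refl

count-all-filterᵇ : (q : ℕ → Bool) (A : List ℕ) (k : ℕ) (R : List ℕ → Bool) →
  count (λ w → all q w ∧ R w) (wordsOver A k) ≡ count R (wordsOver (filterᵇ q A) k)
count-all-filterᵇ q A zero R = refl
count-all-filterᵇ q A (suc k) R = begin
  count (λ w → all q w ∧ R w) (wordsOver A (suc k))
    ≡⟨ sumBy-wordsOver-suc A k _ ⟩
  sumBy (λ x → count (λ w → (q x ∧ all q w) ∧ R (x ∷ w)) (wordsOver A k)) A
    ≡⟨ sumBy-filterᵇ q A dropped ⟩
  sumBy (λ x → count (λ w → (q x ∧ all q w) ∧ R (x ∷ w)) (wordsOver A k)) (filterᵇ q A)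
    ≡⟨ sumBy-cong (filterᵇ q A) kept ⟩
  sumBy (λ x → count (R ∘ (x ∷_)) (wordsOver (filterᵇ q A) k)) (filterᵇ q A)
    ≡⟨ sumBy-wordsOver-suc (filterᵇ q A) k _ ⟨
  count R (wordsOver (filterᵇ q A) (suc k)) ∎
  where
  open ≡-Reasoning
  dropped : ∀ {x} → x ∈ A → q x ≡ false → count (λ w → (q x ∧ all q w) ∧ R (x ∷ w)) (wordsOver A k) ≡ 0
  dropped {x} _ qx rewrite qx = count-false (wordsOver A k)
  kept : ∀ {x} → x ∈ filterᵇ q A →
    count (λ w → (q x ∧ all q w) ∧ R (x ∷ w)) (wordsOver A k) ≡ count (R ∘ (x ∷_)) (wordsOver (filterᵇ q A) k)
  kept {x} x∈ rewrite proj₂ (∈-filterᵇ⁻ q A x∈) = count-all-filterᵇ q A k (R ∘ (x ∷_))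

arrangements-filterᵇ : (q : ℕ → Bool) (A : List ℕ) (k : ℕ) (R : List ℕ → Bool) →
  arrangements A k (λ w → all q w ∧ R w) ≡ arrangements (filterᵇ q A) k R
arrangements-filterᵇ q A k R =
  trans (sumBy-wordsOver-cong A k (λ w _ _ → cong ind (∧-left-comm (distinct w) (all q w) (R w))))
        (count-all-filterᵇ q A k (λ w → distinct w ∧ R w))

arrangements-suc : (A : List ℕ) (k : ℕ) (P : List ℕ → Bool) →
  arrangements A (suc k) P ≡ sumBy (λ b → arrangements (remove b A) k (P ∘ (b ∷_))) A
arrangements-suc A k P = trans (sumBy-wordsOver-suc A k _) (sumBy-cong A (λ {b} _ →
  trans (sumBy-wordsOver-cong A k (λ w _ _ → cong ind (trans (∧-assoc (not (memberᵇ b w)) (distinct w) (P (b ∷ w)))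
                                                              (cong (_∧ (distinct w ∧ P (b ∷ w))) (notMemberᵇ≡all b w)))))
        (count-all-filterᵇ _ A k (λ w → distinct w ∧ P (b ∷ w)))))

arrangements-pigeonhole : (A : List ℕ) (k : ℕ) (P : List ℕ → Bool) → length A < k → arrangements A k P ≡ 0
arrangements-pigeonhole A (suc k) P |A|<k = trans (arrangements-suc A k P) (sumBy-zero A (λ {b} b∈A →
  arrangements-pigeonhole (remove b A) k _ (<-≤-trans (length-remove A b∈A) (≤-pred |A|<k))))

arrangements-suffix-pigeonhole : (q : ℕ → Bool) (A : List ℕ) (i j : ℕ) (R : List ℕ → Bool) →
  length (filterᵇ q A) < j → (∀ w → R w ≡ true → all q (drop i w) ≡ true) → arrangements A (i + j) R ≡ 0
arrangements-suffix-pigeonhole q A zero j R short suffix-in-q = begin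
  arrangements A j R                         ≡⟨ arrangements-cong A j (λ w _ _ _ → R≡all∧R w) ⟩
  arrangements A j (λ w → all q w ∧ R w)     ≡⟨ arrangements-filterᵇ q A j R ⟩
  arrangements (filterᵇ q A) j R             ≡⟨ arrangements-pigeonhole (filterᵇ q A) j R short ⟩
  0                                          ∎
  where
  open ≡-Reasoning
  R≡all∧R : ∀ w → R w ≡ (all q w ∧ R w)
  R≡all∧R w with R w in Rw
  ... | true = sym (trans (∧-identityʳ _) (suffix-in-q w Rw))
  ... | false = sym (∧-zeroʳ _)
arrangements-suffix-pigeonhole q A (suc i) j R short suffix-in-q =
  trans (arrangements-suc A (i + j) R) (sumBy-zero A (λ {b} _ →
    arrangements-suffix-pigeonhole q (remove b A) i j (R ∘ (b ∷_))
      (≤-<-trans (subst (_≤ length (filterᵇ q A)) (cong length (filterᵇ-comm _ q A)) (length-filter _ (filterᵇ q A))) short)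
      (λ w → suffix-in-q (b ∷ w))))

-- Position of a letter

occursAt : ℕ → ℕ → List ℕ → Bool
occursAt M i [] = false
occursAt M zero (x ∷ w) = M ≡ᵇ x
occursAt M (suc i) (x ∷ w) = occursAt M i w

occursAt-∈ : (M i : ℕ) (w : List ℕ) → occursAt M i w ≡ true → M ∈ w
occursAt-∈ M zero (x ∷ w) e = here (≡ᵇ-sound M x e)
occursAt-∈ M (suc i) (x ∷ w) e = there (occursAt-∈ M i w e)

memberᵇ-positions : (M : ℕ) (w : List ℕ) → distinct w ≡ true →
  sumBelow (length w) (λ i → ind (occursAt M i w)) ≡ ind (memberᵇ M w)
memberᵇ-positions M [] d = refl
memberᵇ-positions M (x ∷ w) d with M ≡ᵇ x in M≡x
... | false = memberᵇ-positions M w (proj₂ (distinct-∷ x w d))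
... | true = cong suc (trans (memberᵇ-positions M w (proj₂ (distinct-∷ x w d))) (cong ind (memberᵇ-false M∉w)))
  where
  M∉w : M ∉ w
  M∉w = subst (_∉ w) (sym (≡ᵇ-sound M x M≡x)) (proj₁ (distinct-∷ x w d))

arrangements-positions : (A : List ℕ) (k M : ℕ) (P : List ℕ → Bool) →
  arrangements A k (λ w → memberᵇ M w ∧ P w) ≡ sumBelow k (λ i → arrangements A k (λ w → occursAt M i w ∧ P w))
arrangements-positions A k M P =
  trans (sumBy-wordsOver-cong A k pointwise) (sumBy-sumBelow k (λ i w → ind (distinct w ∧ (occursAt M i w ∧ P w))) (wordsOver A k))
  where
  pointwise : ∀ w → length w ≡ k → All (_∈ A) w →
    ind (distinct w ∧ (memberᵇ M w ∧ P w)) ≡ sumBelow k (λ i → ind (distinct w ∧ (occursAt M i w ∧ P w)))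
  pointwise w refl _ with distinct w in d
  ... | false = sym (sumBelow-zero (length w))
  ... | true = begin
    ind (memberᵇ M w ∧ P w)                                     ≡⟨ ind-∧ (memberᵇ M w) (P w) ⟩
    ind (memberᵇ M w) * ind (P w)                               ≡⟨ cong (_* ind (P w)) (memberᵇ-positions M w d) ⟨
    sumBelow (length w) (λ i → ind (occursAt M i w)) * ind (P w) ≡⟨ sumBelow-*ʳ (length w) _ (ind (P w)) ⟨
    sumBelow (length w) (λ i → ind (occursAt M i w) * ind (P w)) ≡⟨ sumBelow-cong (length w) (λ {i} _ → ind-∧ (occursAt M i w) (P w)) ⟨
    sumBelow (length w) (λ i → ind (occursAt M i w ∧ P w))      ∎
    where open ≡-Reasoning

arrangements-by-position : (A : List ℕ) (k M : ℕ) (P : List ℕ → Bool) → M ∈ A → length A ≡ k →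
  arrangements A k P ≡ sumBelow k (λ i → arrangements A k (λ w → occursAt M i w ∧ P w))
arrangements-by-position A k M P M∈A |A|≡k = begin
  arrangements A k P
    ≡⟨ arrangements-split A k (memberᵇ M) P ⟩
  arrangements A k (λ w → memberᵇ M w ∧ P w) + arrangements A k (λ w → not (memberᵇ M w) ∧ P w)
    ≡⟨ cong₂ _+_ (arrangements-positions A k M P) M-missing ⟩
  sumBelow k (λ i → arrangements A k (λ w → occursAt M i w ∧ P w)) + 0
    ≡⟨ +-identityʳ _ ⟩
  sumBelow k (λ i → arrangements A k (λ w → occursAt M i w ∧ P w)) ∎
  where
  open ≡-Reasoning
  M-missing : arrangements A k (λ w → not (memberᵇ M w) ∧ P w) ≡ 0
  M-missing = begin
    arrangements A k (λ w → not (memberᵇ M w) ∧ P w)  ≡⟨ arrangements-cong A k (λ w _ _ _ → cong (_∧ P w) (notMemberᵇ≡all M w)) ⟩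
    arrangements A k (λ w → all _ w ∧ P w)            ≡⟨ arrangements-filterᵇ _ A k P ⟩
    arrangements (remove M A) k P                     ≡⟨ arrangements-pigeonhole (remove M A) k P
                                                           (subst (length (remove M A) <_) |A|≡k (length-remove A M∈A)) ⟩
    0                                                 ∎

arrangements-occursAt : (A : List ℕ) (M i m : ℕ) (P : List ℕ → Bool) → distinct A ≡ true → M ∈ A → i ≤ m →
  arrangements A (suc m) (λ w → occursAt M i w ∧ P w) ≡ arrangements (remove M A) m (λ w → P (take i w ++ M ∷ drop i w))
arrangements-occursAt A M zero m P d M∈A _ = begin
  arrangements A (suc m) (λ w → occursAt M 0 w ∧ P w)
    ≡⟨ arrangements-suc A m _ ⟩
  sumBy (λ b → arrangements (remove b A) m (λ w → (M ≡ᵇ b) ∧ P (b ∷ w))) A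
    ≡⟨ sumBy-unique A d M∈A (λ {b} _ b≢M → arrangements-none (remove b A) m (λ w _ _ _ →
         cong (_∧ P (b ∷ w)) (≢⇒≡ᵇ-false M b (b≢M ∘ sym)))) ⟩
  arrangements (remove M A) m (λ w → (M ≡ᵇ M) ∧ P (M ∷ w))
    ≡⟨ cong (λ b → arrangements (remove M A) m (λ w → b ∧ P (M ∷ w))) (≡ᵇ-refl M) ⟩
  arrangements (remove M A) m (λ w → P (M ∷ w)) ∎
  where open ≡-Reasoning
arrangements-occursAt A M (suc i) (suc m) P d M∈A (s≤s i≤m) = begin
  arrangements A (suc (suc m)) (λ w → occursAt M (suc i) w ∧ P w)
    ≡⟨ arrangements-suc A (suc m) _ ⟩
  sumBy (λ b → arrangements (remove b A) (suc m) (λ w → occursAt M i w ∧ P (b ∷ w))) A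
    ≡⟨ sumBy-filterᵇ _ A (λ {b} _ b≡M → arrangements-none (remove b A) (suc m) (λ w _ w⊆A-b _ →
         no-M w (subst (λ c → All (_∈ remove c A) w) (sym (≡ᵇ-sound M b (not-injective b≡M))) w⊆A-b))) ⟩
  sumBy (λ b → arrangements (remove b A) (suc m) (λ w → occursAt M i w ∧ P (b ∷ w))) (remove M A)
    ≡⟨ sumBy-cong (remove M A) (λ {b} b∈A-M → trans
         (arrangements-occursAt (remove b A) M i m (P ∘ (b ∷_)) (distinct-filterᵇ _ A d)
                                (∈-remove⁺ M∈A (proj₂ (∈-remove⁻ M A b∈A-M) ∘ sym)) i≤m)
         (cong (λ B → arrangements B m (λ w → P (b ∷ take i w ++ M ∷ drop i w))) (filterᵇ-comm _ _ A))) ⟩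
  sumBy (λ b → arrangements (remove b (remove M A)) m (λ w → P (b ∷ take i w ++ M ∷ drop i w))) (remove M A)
    ≡⟨ arrangements-suc (remove M A) m _ ⟨
  arrangements (remove M A) (suc m) (λ w → P (take (suc i) w ++ M ∷ drop (suc i) w)) ∎
  where
  open ≡-Reasoning
  no-M : ∀ {c} w → All (_∈ remove M A) w → (occursAt M i w ∧ c) ≡ false
  no-M w w⊆A-M with occursAt M i w in Mw
  ... | true = ⊥-elim (∉-remove M A (lookup w⊆A-M (occursAt-∈ M i w Mw)))
  ... | false = refl

-- Words split into two separated blocks

all-true : (q : ℕ → Bool) (v : List ℕ) → (∀ {y} → y ∈ v → q y ≡ true) → all q v ≡ true
all-true q [] h = refl
all-true q (y ∷ v) h rewrite h (here refl) = all-true q v (h ∘ there)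

relAll : (ℕ → ℕ → Bool) → List ℕ → List ℕ → Bool
relAll rel [] v = true
relAll rel (x ∷ u) v = all (rel x) v ∧ relAll rel u v

Separated : (ℕ → Bool) → (ℕ → ℕ → Bool) → List ℕ → Set
Separated inX rel U = ∀ {x y} → x ∈ U → y ∈ U → inX x ≡ true → inX y ≡ false → rel x y ≡ true × rel y x ≡ false

separated-remove : {inX : ℕ → Bool} {rel : ℕ → ℕ → Bool} (b : ℕ) (U : List ℕ) →
  Separated inX rel U → Separated inX rel (remove b U)
separated-remove b U sep x∈ y∈ = sep (proj₁ (∈-remove⁻ b U x∈)) (proj₁ (∈-remove⁻ b U y∈))

splitsAt : (rel : ℕ → ℕ → Bool) (i : ℕ) (P₁ P₂ : List ℕ → Bool) → List ℕ → Bool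
splitsAt rel i P₁ P₂ w = relAll rel (take i w) (drop i w) ∧ (P₁ (take i w) ∧ P₂ (drop i w))

-- A prefix starting with a letter b of the second block forces all j letters after the prefix
-- into the second block minus b, which is too small.
arrangements-separated-misplaced : (inX : ℕ → Bool) (rel : ℕ → ℕ → Bool) (U : List ℕ) (i j : ℕ) (P₁ P₂ : List ℕ → Bool) →
  distinct U ≡ true → Separated inX rel U → length (filterᵇ (not ∘ inX) U) ≡ j →
  ∀ {b} → b ∈ U → inX b ≡ false → arrangements (remove b U) (i + j) (splitsAt rel (suc i) P₁ P₂ ∘ (b ∷_)) ≡ 0
arrangements-separated-misplaced inX rel U i j P₁ P₂ d sep |Y|≡j {b} b∈U b∉X =
  arrangements-suffix-pigeonhole (rel b) (remove b U) i j _ short (λ w e → proj₁ (∧-true (proj₁ (∧-true e))))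
  where
  Y : List ℕ
  Y = filterᵇ (not ∘ inX) U
  rel-b⇒Y : ∀ {z} → z ∈ remove b U → rel b z ≡ true → not (inX z) ≡ true
  rel-b⇒Y {z} z∈ rel-b-z with inX z in z∈X
  ... | false = refl
  ... | true = ⊥-elim (true≢false (trans (sym rel-b-z) (proj₂ (sep (proj₁ (∈-remove⁻ b U z∈)) b∈U z∈X b∉X))))
  short : length (filterᵇ (rel b) (remove b U)) < j
  short = begin-strict
    length (filterᵇ (rel b) (remove b U))         ≤⟨ length-filterᵇ-mono _ _ (remove b U) rel-b⇒Y ⟩
    length (filterᵇ (not ∘ inX) (remove b U))     ≡⟨ cong length (filterᵇ-comm _ _ U) ⟩
    length (remove b Y)                           <⟨ n<1+n _ ⟩
    suc (length (remove b Y))                     ≡⟨ length-remove-distinct Y (distinct-filterᵇ _ U d) (∈-filterᵇ⁺ _ b∈U (cong not b∉X)) ⟩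
    length Y                                      ≡⟨ |Y|≡j ⟩
    j                                             ∎
    where open ≤-Reasoning

arrangements-separated : (inX : ℕ → Bool) (rel : ℕ → ℕ → Bool) (U : List ℕ) (i j : ℕ) (P₁ P₂ : List ℕ → Bool) →
  distinct U ≡ true → Separated inX rel U →
  length (filterᵇ inX U) ≡ i → length (filterᵇ (not ∘ inX) U) ≡ j →
  arrangements U (i + j) (splitsAt rel i P₁ P₂)
    ≡ arrangements (filterᵇ inX U) i P₁ * arrangements (filterᵇ (not ∘ inX) U) j P₂
arrangements-separated inX rel U zero j P₁ P₂ d sep |X|≡0 _ = begin
  arrangements U j (λ w → P₁ [] ∧ P₂ w)                  ≡⟨ arrangements-const U j (P₁ []) P₂ ⟩
  ind (P₁ []) * arrangements U j P₂                       ≡⟨ cong₂ _*_ (+-identityʳ (ind (P₁ []))) (cong (λ Y → arrangements Y j P₂) Y≡U) ⟨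
  (ind (P₁ []) + 0) * arrangements (filterᵇ (not ∘ inX) U) j P₂ ∎
  where
  open ≡-Reasoning
  Y≡U : filterᵇ (not ∘ inX) U ≡ U
  Y≡U = filterᵇ-all _ U (cong not ∘ length-filterᵇ≡0 inX U |X|≡0)
arrangements-separated inX rel U (suc i) j P₁ P₂ d sep |X|≡1+i |Y|≡j = begin
  arrangements U (suc (i + j)) (splitsAt rel (suc i) P₁ P₂)
    ≡⟨ arrangements-suc U (i + j) _ ⟩
  sumBy (λ b → arrangements (remove b U) (i + j) (splitsAt rel (suc i) P₁ P₂ ∘ (b ∷_))) U
    ≡⟨ sumBy-filterᵇ inX U (arrangements-separated-misplaced inX rel U i j P₁ P₂ d sep |Y|≡j) ⟩
  sumBy (λ b → arrangements (remove b U) (i + j) (splitsAt rel (suc i) P₁ P₂ ∘ (b ∷_))) X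
    ≡⟨ sumBy-cong X first-block-first ⟩
  sumBy (λ b → arrangements (remove b X) i (P₁ ∘ (b ∷_)) * arrangements Y j P₂) X
    ≡⟨ sumBy-*ʳ _ (arrangements Y j P₂) X ⟩
  sumBy (λ b → arrangements (remove b X) i (P₁ ∘ (b ∷_))) X * arrangements Y j P₂
    ≡⟨ cong (_* arrangements Y j P₂) (arrangements-suc X i P₁) ⟨
  arrangements X (suc i) P₁ * arrangements Y j P₂ ∎
  where
  open ≡-Reasoning
  X Y : List ℕ
  X = filterᵇ inX U
  Y = filterᵇ (not ∘ inX) U

  first-block-first : ∀ {b} → b ∈ X →
    arrangements (remove b U) (i + j) (splitsAt rel (suc i) P₁ P₂ ∘ (b ∷_))
      ≡ arrangements (remove b X) i (P₁ ∘ (b ∷_)) * arrangements Y j P₂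
  first-block-first {b} b∈X = begin
    arrangements (remove b U) (i + j) (splitsAt rel (suc i) P₁ P₂ ∘ (b ∷_))
      ≡⟨ arrangements-cong (remove b U) (i + j) (λ w _ _ _ →
           shuffle (all (rel b) (drop i w)) (relAll rel (take i w) (drop i w)) (P₁ (b ∷ take i w)) (P₂ (drop i w))) ⟩
    arrangements (remove b U) (i + j) (splitsAt rel i P₁′ P₂′)
      ≡⟨ arrangements-separated inX rel (remove b U) i j P₁′ P₂′ (distinct-filterᵇ _ U d) (separated-remove b U sep)
           (trans (cong length (filterᵇ-comm inX _ U)) |X-b|≡i) (trans (cong length Y-b≡Y) |Y|≡j) ⟩
    arrangements (filterᵇ inX (remove b U)) i P₁′ * arrangements (filterᵇ (not ∘ inX) (remove b U)) j P₂′
      ≡⟨ cong₂ (λ X′ Y′ → arrangements X′ i P₁′ * arrangements Y′ j P₂′) (filterᵇ-comm inX _ U) Y-b≡Y ⟩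
    arrangements (remove b X) i P₁′ * arrangements Y j P₂′
      ≡⟨ cong (arrangements (remove b X) i P₁′ *_) (arrangements-cong Y j (λ v _ v⊆Y _ →
           cong (_∧ P₂ v) (all-true (rel b) v (λ y∈v → rel-b-Y (lookup v⊆Y y∈v))))) ⟩
    arrangements (remove b X) i P₁′ * arrangements Y j P₂ ∎
    where
    P₁′ P₂′ : List ℕ → Bool
    P₁′ = P₁ ∘ (b ∷_)
    P₂′ v = all (rel b) v ∧ P₂ v
    b∈U : b ∈ U
    b∈U = proj₁ (∈-filterᵇ⁻ inX U b∈X)
    b-inX : inX b ≡ true
    b-inX = proj₂ (∈-filterᵇ⁻ inX U b∈X)
    shuffle : ∀ a r p q → ((a ∧ r) ∧ (p ∧ q)) ≡ (r ∧ (p ∧ (a ∧ q)))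
    shuffle true r p q = refl
    shuffle false r p q = sym (trans (cong (r ∧_) (∧-zeroʳ p)) (∧-zeroʳ r))
    Y-b≡Y : filterᵇ (not ∘ inX) (remove b U) ≡ Y
    Y-b≡Y = trans (filterᵇ-comm _ _ U) (remove-∉ Y (λ b∈Y → true≢false (trans (sym b-inX)
              (not-injective (proj₂ (∈-filterᵇ⁻ _ U b∈Y))))))
    |X-b|≡i : length (remove b X) ≡ i
    |X-b|≡i = suc-injective (trans (length-remove-distinct X (distinct-filterᵇ inX U d) b∈X) |X|≡1+i)
    rel-b-Y : ∀ {y} → y ∈ Y → rel b y ≡ true
    rel-b-Y y∈Y = proj₁ (sep b∈U (proj₁ (∈-filterᵇ⁻ _ U y∈Y)) b-inX (not-injective (proj₂ (∈-filterᵇ⁻ _ U y∈Y))))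

-- Intervals and shifts

range : ℕ → ℕ → List ℕ
range lo zero = []
range lo (suc n) = lo ∷ range (suc lo) n

length-range : (lo n : ℕ) → length (range lo n) ≡ n
length-range lo zero = refl
length-range lo (suc n) = cong suc (length-range (suc lo) n)

∈-range⁻ : {x : ℕ} (lo n : ℕ) → x ∈ range lo n → lo ≤ x × x < lo + n
∈-range⁻ lo (suc n) (here refl) = ≤-refl , subst (lo <_) (sym (+-suc lo n)) (s≤s (m≤m+n lo n))
∈-range⁻ {x} lo (suc n) (there x∈) with ∈-range⁻ (suc lo) n x∈
... | lo<x , x<1+lo+n = <⇒≤ lo<x , subst (x <_) (sym (+-suc lo n)) x<1+lo+n

∈-range⁺ : {x : ℕ} (lo n : ℕ) → lo ≤ x → x < lo + n → x ∈ range lo n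
∈-range⁺ {x} lo zero lo≤x x<lo+0 = ⊥-elim (<⇒≱ x<lo+0 (subst (_≤ x) (sym (+-identityʳ lo)) lo≤x))
∈-range⁺ {x} lo (suc n) lo≤x x<lo+n with m≤n⇒m<n∨m≡n lo≤x
... | inj₂ refl = here refl
... | inj₁ lo<x = there (∈-range⁺ (suc lo) n lo<x (subst (x <_) (+-suc lo n) x<lo+n))

distinct-range : (lo n : ℕ) → distinct (range lo n) ≡ true
distinct-range lo zero = refl
distinct-range lo (suc n) = distinct-∷⁺ (λ lo∈ → <-irrefl refl (proj₁ (∈-range⁻ (suc lo) n lo∈))) (distinct-range (suc lo) n)

range-++ : (lo p q : ℕ) → range lo (p + q) ≡ range lo p ++ range (lo + p) q
range-++ lo zero q = cong (λ a → range a q) (sym (+-identityʳ lo))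
range-++ lo (suc p) q = cong (lo ∷_) (trans (range-++ (suc lo) p q) (cong (λ a → range (suc lo) p ++ range a q) (sym (+-suc lo p))))

range-suc : (lo n : ℕ) → range (suc lo) n ≡ map suc (range lo n)
range-suc lo zero = refl
range-suc lo (suc n) = cong (suc lo ∷_) (range-suc (suc lo) n)

remove-range-last : (lo m : ℕ) → remove (lo + m) (range lo (suc m)) ≡ range lo m
remove-range-last lo zero rewrite +-identityʳ lo | ≡ᵇ-refl lo = refl
remove-range-last lo (suc m) rewrite ≢⇒≡ᵇ-false (lo + suc m) lo (m+1+n≢m lo) | +-suc lo m =
  cong (lo ∷_) (remove-range-last (suc lo) m)

ShiftInvariant : (List ℕ → Bool) → Set
ShiftInvariant P = ∀ w → P (map suc w) ≡ P w

sumBy-wordsOver-map : (f : ℕ → ℕ) (A : List ℕ) (k : ℕ) (g : List ℕ → ℕ) →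
  sumBy g (wordsOver (map f A) k) ≡ sumBy (g ∘ map f) (wordsOver A k)
sumBy-wordsOver-map f A zero g = refl
sumBy-wordsOver-map f A (suc k) g = begin
  sumBy g (wordsOver (map f A) (suc k))                              ≡⟨ sumBy-wordsOver-suc (map f A) k g ⟩
  sumBy (λ x → sumBy (g ∘ (x ∷_)) (wordsOver (map f A) k)) (map f A) ≡⟨ sumBy-map _ f A ⟩
  sumBy (λ a → sumBy (g ∘ (f a ∷_)) (wordsOver (map f A) k)) A       ≡⟨ sumBy-cong A (λ {a} _ → sumBy-wordsOver-map f A k (g ∘ (f a ∷_))) ⟩
  sumBy (λ a → sumBy (g ∘ map f ∘ (a ∷_)) (wordsOver A k)) A         ≡⟨ sumBy-wordsOver-suc A k (g ∘ map f) ⟨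
  sumBy (g ∘ map f) (wordsOver A (suc k))                            ∎
  where open ≡-Reasoning

memberᵇ-map-suc : (x : ℕ) (w : List ℕ) → memberᵇ (suc x) (map suc w) ≡ memberᵇ x w
memberᵇ-map-suc x [] = refl
memberᵇ-map-suc x (y ∷ w) = cong ((x ≡ᵇ y) ∨_) (memberᵇ-map-suc x w)

distinct-shift : ShiftInvariant distinct
distinct-shift [] = refl
distinct-shift (x ∷ w) = cong₂ (λ a b → not a ∧ b) (memberᵇ-map-suc x w) (distinct-shift w)

arrangements-map-suc : (A : List ℕ) (k : ℕ) (P : List ℕ → Bool) → ShiftInvariant P →
  arrangements (map suc A) k P ≡ arrangements A k P
arrangements-map-suc A k P P-shift = trans (sumBy-wordsOver-map suc A k _)
  (sumBy-wordsOver-cong A k (λ w _ _ → cong ind (cong₂ _∧_ (distinct-shift w) (P-shift w))))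

arrangements-range-shift : (lo n k : ℕ) (P : List ℕ → Bool) → ShiftInvariant P →
  arrangements (range lo n) k P ≡ arrangements (range 0 n) k P
arrangements-range-shift zero n k P P-shift = refl
arrangements-range-shift (suc lo) n k P P-shift = begin
  arrangements (range (suc lo) n) k P     ≡⟨ cong (λ A → arrangements A k P) (range-suc lo n) ⟩
  arrangements (map suc (range lo n)) k P ≡⟨ arrangements-map-suc (range lo n) k P P-shift ⟩
  arrangements (range lo n) k P           ≡⟨ arrangements-range-shift lo n k P P-shift ⟩
  arrangements (range 0 n) k P            ∎
  where open ≡-Reasoning

-- Pattern occurrences

anyᵇ-++ : {A : Set} (p : A → Bool) (xs ys : List A) → anyᵇ p (xs ++ ys) ≡ (anyᵇ p xs ∨ anyᵇ p ys)
anyᵇ-++ p [] ys = refl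
anyᵇ-++ p (x ∷ xs) ys = trans (cong (p x ∨_) (anyᵇ-++ p xs ys)) (sym (∨-assoc (p x) _ _))

anyᵇ-map : {A B : Set} (p : B → Bool) (f : A → B) (xs : List A) → anyᵇ p (map f xs) ≡ anyᵇ (p ∘ f) xs
anyᵇ-map p f [] = refl
anyᵇ-map p f (x ∷ xs) = cong (p (f x) ∨_) (anyᵇ-map p f xs)

anyᵇ-cong : {p q : ℕ → Bool} (xs : List ℕ) → (∀ {x} → x ∈ xs → p x ≡ q x) → anyᵇ p xs ≡ anyᵇ q xs
anyᵇ-cong [] h = refl
anyᵇ-cong (x ∷ xs) h = cong₂ _∨_ (h (here refl)) (anyᵇ-cong xs (h ∘ there))

anyᵇ-mono : {p q : ℕ → Bool} (xs : List ℕ) → (∀ x → p x ≡ true → q x ≡ true) → anyᵇ p xs ≡ true → anyᵇ q xs ≡ true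
anyᵇ-mono {p} {q} (x ∷ xs) h e with p x in px | q x in qx
... | _ | true = refl
... | true | false = ⊥-elim (true≢false (trans (sym (h x px)) qx))
... | false | false = anyᵇ-mono xs h e

anyᵇ-shift : {p q : ℕ → Bool} (w : List ℕ) → (∀ z → p (suc z) ≡ q z) → anyᵇ p (map suc w) ≡ anyᵇ q w
anyᵇ-shift [] e = refl
anyᵇ-shift (z ∷ w) e = cong₂ _∨_ (e z) (anyᵇ-shift w e)

anyPair : (ℕ → ℕ → Bool) → List ℕ → Bool
anyPair g [] = false
anyPair g (y ∷ w) = anyᵇ (g y) w ∨ anyPair g w

anyTriple : (ℕ → ℕ → ℕ → Bool) → List ℕ → Bool
anyTriple T [] = false
anyTriple T (x ∷ w) = anyPair (T x) w ∨ anyTriple T w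

anyPair-cong : {g h : ℕ → ℕ → Bool} (w : List ℕ) → (∀ y z → g y z ≡ h y z) → anyPair g w ≡ anyPair h w
anyPair-cong [] e = refl
anyPair-cong (y ∷ w) e = cong₂ _∨_ (anyᵇ-cong w (λ {z} _ → e y z)) (anyPair-cong w e)

anyTriple-cong : {S T : ℕ → ℕ → ℕ → Bool} (w : List ℕ) → (∀ x y z → S x y z ≡ T x y z) → anyTriple S w ≡ anyTriple T w
anyTriple-cong [] e = refl
anyTriple-cong (x ∷ w) e = cong₂ _∨_ (anyPair-cong w (e x)) (anyTriple-cong w e)

anyPair-shift : {g h : ℕ → ℕ → Bool} (w : List ℕ) → (∀ y z → g (suc y) (suc z) ≡ h y z) → anyPair g (map suc w) ≡ anyPair h w
anyPair-shift [] e = refl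
anyPair-shift (y ∷ w) e = cong₂ _∨_ (anyᵇ-shift w (e y)) (anyPair-shift w e)

anyTriple-shift : (T : ℕ → ℕ → ℕ → Bool) → (∀ x y z → T (suc x) (suc y) (suc z) ≡ T x y z) →
  ShiftInvariant (anyTriple T)
anyTriple-shift T e [] = refl
anyTriple-shift T e (x ∷ w) = cong₂ _∨_ (anyPair-shift w (e x)) (anyTriple-shift T e w)

-- As for rev, subseqs and occurs3 in Defs use where-bound helpers (a copy of _++_, and match);
-- each mutual block lets unification name one of them. The constructor in the with-clause is
-- qualified because All's _∷_ is in scope too, and an ambiguous one defeats the abstraction.
mutual
  subseqsAppend : ℕ → ℕ → List ℕ → List (List ℕ) → List (List ℕ) → List (List ℕ)
  subseqsAppend = _

  subseqs-suc-∷-local : ∀ k x xs →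
    subseqs (suc k) (x ∷ xs) ≡ subseqsAppend k x xs (map (x ∷_) (subseqs k xs)) (subseqs (suc k) xs)
  subseqs-suc-∷-local k x xs with map (List._∷_ x) (subseqs k xs) | subseqs (suc k) xs
  ... | ys | zs = refl

subseqsAppend≡++ : ∀ k x xs ys zs → subseqsAppend k x xs ys zs ≡ ys ++ zs
subseqsAppend≡++ k x xs [] zs = refl
subseqsAppend≡++ k x xs (y ∷ ys) zs = cong (y ∷_) (subseqsAppend≡++ k x xs ys zs)

subseqs-suc-∷ : ∀ k x xs → subseqs (suc k) (x ∷ xs) ≡ map (x ∷_) (subseqs k xs) ++ subseqs (suc k) xs
subseqs-suc-∷ k x xs = trans (subseqs-suc-∷-local k x xs) (subseqsAppend≡++ k x xs (map (x ∷_) (subseqs k xs)) (subseqs (suc k) xs))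

mutual
  occurs3Match : ℕ → ℕ → ℕ → List ℕ → List ℕ → Bool
  occurs3Match = _

  occurs3-local : ∀ a b c w → occurs3 a b c w ≡ anyᵇ (occurs3Match a b c w) (subseqs 3 w)
  occurs3-local a b c w = refl

module _ (a b c : ℕ) (w₀ : List ℕ) where
  private
    match : List ℕ → Bool
    match = occurs3Match a b c w₀

  anyᵇ-match-subseqs1 : (x y : ℕ) (zs : List ℕ) → anyᵇ (match ∘ (x ∷_) ∘ (y ∷_)) (subseqs 1 zs) ≡ anyᵇ (iso3 a b c x y) zs
  anyᵇ-match-subseqs1 x y [] = refl
  anyᵇ-match-subseqs1 x y (z ∷ zs) = cong (iso3 a b c x y z ∨_) (anyᵇ-match-subseqs1 x y zs)

  anyᵇ-match-subseqs2 : (x : ℕ) (ys : List ℕ) → anyᵇ (match ∘ (x ∷_)) (subseqs 2 ys) ≡ anyPair (iso3 a b c x) ys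
  anyᵇ-match-subseqs2 x [] = refl
  anyᵇ-match-subseqs2 x (y ∷ ys) = begin
    anyᵇ (match ∘ (x ∷_)) (subseqs 2 (y ∷ ys))
      ≡⟨ cong (anyᵇ (match ∘ (x ∷_))) (subseqs-suc-∷ 1 y ys) ⟩
    anyᵇ (match ∘ (x ∷_)) (map (y ∷_) (subseqs 1 ys) ++ subseqs 2 ys)
      ≡⟨ anyᵇ-++ _ (map (y ∷_) (subseqs 1 ys)) (subseqs 2 ys) ⟩
    anyᵇ (match ∘ (x ∷_)) (map (y ∷_) (subseqs 1 ys)) ∨ anyᵇ (match ∘ (x ∷_)) (subseqs 2 ys)
      ≡⟨ cong₂ _∨_ (trans (anyᵇ-map _ (y ∷_) (subseqs 1 ys)) (anyᵇ-match-subseqs1 x y ys)) (anyᵇ-match-subseqs2 x ys) ⟩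
    anyPair (iso3 a b c x) (y ∷ ys) ∎
    where open ≡-Reasoning

  anyᵇ-match-subseqs3 : (xs : List ℕ) → anyᵇ match (subseqs 3 xs) ≡ anyTriple (iso3 a b c) xs
  anyᵇ-match-subseqs3 [] = refl
  anyᵇ-match-subseqs3 (x ∷ xs) = begin
    anyᵇ match (subseqs 3 (x ∷ xs))
      ≡⟨ cong (anyᵇ match) (subseqs-suc-∷ 2 x xs) ⟩
    anyᵇ match (map (x ∷_) (subseqs 2 xs) ++ subseqs 3 xs)
      ≡⟨ anyᵇ-++ _ (map (x ∷_) (subseqs 2 xs)) (subseqs 3 xs) ⟩
    anyᵇ match (map (x ∷_) (subseqs 2 xs)) ∨ anyᵇ match (subseqs 3 xs)
      ≡⟨ cong₂ _∨_ (trans (anyᵇ-map _ (x ∷_) (subseqs 2 xs)) (anyᵇ-match-subseqs2 x xs)) (anyᵇ-match-subseqs3 xs) ⟩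
    anyTriple (iso3 a b c) (x ∷ xs) ∎
    where open ≡-Reasoning

occurs3≡anyTriple : (a b c : ℕ) (w : List ℕ) → occurs3 a b c w ≡ anyTriple (iso3 a b c) w
occurs3≡anyTriple a b c w = anyᵇ-match-subseqs3 a b c w w

isOccurrence : Pattern → ℕ → ℕ → ℕ → Bool
isOccurrence p132 x y z = (x <ᵇ z) ∧ (z <ᵇ y)
isOccurrence p231 x y z = (z <ᵇ x) ∧ (x <ᵇ y)

∧-zeroʳ₅ : ∀ a b c d e → (a ∧ (b ∧ (c ∧ (d ∧ (e ∧ false))))) ≡ false
∧-zeroʳ₅ a b c d e rewrite ∧-zeroʳ e | ∧-zeroʳ d | ∧-zeroʳ c | ∧-zeroʳ b = ∧-zeroʳ a

iso3-132 : (x y z : ℕ) → iso3 1 3 2 x y z ≡ isOccurrence p132 x y z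
iso3-132 x y z with x <ᵇ z in x<z | z <ᵇ y in z<y
... | false | _ = ∧-zeroʳ₅ (sameOrder 1 3 x y) (sameOrder 3 1 y x) false false false
... | true | false = ∧-zeroʳ₅ (sameOrder 1 3 x y) (sameOrder 3 1 y x) true (sameOrder 2 1 z x) (sameOrder 3 2 y z)
... | true | true
  rewrite <ᵇ-true (<-trans (<ᵇ-sound x z x<z) (<ᵇ-sound z y z<y))
        | <ᵇ-false {y} {x} (<⇒≤ (<-trans (<ᵇ-sound x z x<z) (<ᵇ-sound z y z<y)))
        | <ᵇ-false {z} {x} (<⇒≤ (<ᵇ-sound x z x<z))
        | <ᵇ-false {y} {z} (<⇒≤ (<ᵇ-sound z y z<y)) = refl

iso3-231 : (x y z : ℕ) → iso3 2 3 1 x y z ≡ isOccurrence p231 x y z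
iso3-231 x y z with z <ᵇ x in z<x | x <ᵇ y in x<y
... | z<ᵇx | false = sym (∧-zeroʳ z<ᵇx)
... | false | true = ∧-zeroʳ₅ true (sameOrder 3 2 y x) (sameOrder 2 1 x z) false false
... | true | true
  rewrite <ᵇ-false {y} {x} (<⇒≤ (<ᵇ-sound x y x<y))
        | <ᵇ-false {x} {z} (<⇒≤ (<ᵇ-sound z x z<x))
        | <ᵇ-false {y} {z} (<⇒≤ (<-trans (<ᵇ-sound z x z<x) (<ᵇ-sound x y x<y)))
        | <ᵇ-true (<-trans (<ᵇ-sound z x z<x) (<ᵇ-sound x y x<y)) = refl

avoids≡noOccurrence : (σ : Pattern) (w : List ℕ) → avoids σ w ≡ not (anyTriple (isOccurrence σ) w)
avoids≡noOccurrence p132 w = cong not (trans (occurs3≡anyTriple 1 3 2 w) (anyTriple-cong w iso3-132))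
avoids≡noOccurrence p231 w = cong not (trans (occurs3≡anyTriple 2 3 1 w) (anyTriple-cong w iso3-231))

avoids-shift : (σ : Pattern) → ShiftInvariant (avoids σ)
avoids-shift σ w = begin
  avoids σ (map suc w)                               ≡⟨ avoids≡noOccurrence σ (map suc w) ⟩
  not (anyTriple (isOccurrence σ) (map suc w))       ≡⟨ cong not (anyTriple-shift (isOccurrence σ) (occurrence-shift σ) w) ⟩
  not (anyTriple (isOccurrence σ) w)                 ≡⟨ avoids≡noOccurrence σ w ⟨
  avoids σ w                                         ∎
  where
  open ≡-Reasoning
  occurrence-shift : (σ : Pattern) (x y z : ℕ) → isOccurrence σ (suc x) (suc y) (suc z) ≡ isOccurrence σ x y z
  occurrence-shift p132 x y z = refl
  occurrence-shift p231 x y z = refl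

-- x before the maximum M and z after it form the occurrence x M z of σ.
crossesMax : Pattern → ℕ → ℕ → Bool
crossesMax p132 x z = x <ᵇ z
crossesMax p231 x z = z <ᵇ x

occurrence-max-first : (σ : Pattern) {M y z : ℕ} → y < M → z < M → isOccurrence σ M y z ≡ false
occurrence-max-first p132 y<M z<M rewrite <ᵇ-false (<⇒≤ z<M) = refl
occurrence-max-first p231 y<M z<M rewrite <ᵇ-false (<⇒≤ y<M) = ∧-zeroʳ _

occurrence-max-middle : (σ : Pattern) {M x z : ℕ} → x < M → z < M → isOccurrence σ x M z ≡ crossesMax σ x z
occurrence-max-middle p132 x<M z<M rewrite <ᵇ-true z<M = ∧-identityʳ _
occurrence-max-middle p231 x<M z<M rewrite <ᵇ-true x<M = ∧-identityʳ _

occurrence-max-last : (σ : Pattern) {M x y : ℕ} → x < M → y < M → isOccurrence σ x y M ≡ false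
occurrence-max-last p132 x<M y<M rewrite <ᵇ-false (<⇒≤ y<M) = ∧-zeroʳ _
occurrence-max-last p231 x<M y<M rewrite <ᵇ-false (<⇒≤ x<M) = refl

occurrence⇒crossesMax : (σ : Pattern) (x y z : ℕ) → isOccurrence σ x y z ≡ true → crossesMax σ x z ≡ true
occurrence⇒crossesMax p132 x y z e = proj₁ (∧-true e)
occurrence⇒crossesMax p231 x y z e = proj₁ (∧-true e)

crossing : Pattern → List ℕ → List ℕ → Bool
crossing σ u v = anyᵇ (λ x → anyᵇ (crossesMax σ x) v) u

anyPair-occurrence⇒crossesMax : (σ : Pattern) (x : ℕ) (v : List ℕ) →
  anyPair (isOccurrence σ x) v ≡ true → anyᵇ (crossesMax σ x) v ≡ true
anyPair-occurrence⇒crossesMax σ x (y ∷ v) e with anyᵇ (isOccurrence σ x y) v in e₁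
... | true = trans (cong (crossesMax σ x y ∨_) (anyᵇ-mono v (occurrence⇒crossesMax σ x y) e₁)) (∨-zeroʳ _)
... | false = trans (cong (crossesMax σ x y ∨_) (anyPair-occurrence⇒crossesMax σ x v e)) (∨-zeroʳ _)

anyPair-max : (σ : Pattern) {M : ℕ} (v : List ℕ) → All (_< M) v → anyPair (isOccurrence σ M) v ≡ false
anyPair-max σ [] [] = refl
anyPair-max σ (y ∷ v) (y<M ∷ v<M) =
  cong₂ _∨_ (trans (anyᵇ-cong v (λ z∈v → occurrence-max-first σ y<M (lookup v<M z∈v))) (anyᵇ-false v))
            (anyPair-max σ v v<M)
  where
  anyᵇ-false : (xs : List ℕ) → anyᵇ (λ _ → false) xs ≡ false
  anyᵇ-false [] = refl
  anyᵇ-false (_ ∷ xs) = anyᵇ-false xs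

-- An occurrence x y z with y before and z after M is subsumed by the occurrence x M z.
anyPair-++-max : (σ : Pattern) {M x : ℕ} (u v : List ℕ) → x < M → All (_< M) u → All (_< M) v →
  anyPair (isOccurrence σ x) (u ++ M ∷ v) ≡ (anyPair (isOccurrence σ x) u ∨ anyᵇ (crossesMax σ x) v)
anyPair-++-max σ {M} {x} [] v x<M [] v<M =
  trans (cong (_∨ anyPair (isOccurrence σ x) v) (anyᵇ-cong v (λ z∈v → occurrence-max-middle σ x<M (lookup v<M z∈v))))
        (∨-absorb _ _ (anyPair-occurrence⇒crossesMax σ x v))
  where
  ∨-absorb : ∀ a b → (b ≡ true → a ≡ true) → (a ∨ b) ≡ a
  ∨-absorb true b _ = refl
  ∨-absorb false false _ = refl
  ∨-absorb false true b⇒a = sym (b⇒a refl)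
anyPair-++-max σ {M} {x} (y ∷ u) v x<M (y<M ∷ u<M) v<M = begin
  anyᵇ (isOccurrence σ x y) (u ++ M ∷ v) ∨ anyPair (isOccurrence σ x) (u ++ M ∷ v)
    ≡⟨ cong₂ _∨_ (trans (anyᵇ-++ _ u (M ∷ v))
                        (cong (λ t → anyᵇ (isOccurrence σ x y) u ∨ (t ∨ anyᵇ (isOccurrence σ x y) v))
                              (occurrence-max-last σ x<M y<M)))
                 (anyPair-++-max σ u v x<M u<M v<M) ⟩
  (anyᵇ (isOccurrence σ x y) u ∨ anyᵇ (isOccurrence σ x y) v) ∨ (anyPair (isOccurrence σ x) u ∨ anyᵇ (crossesMax σ x) v)
    ≡⟨ rearrange (anyᵇ (isOccurrence σ x y) u) _ (anyPair (isOccurrence σ x) u) _ (anyᵇ-mono v (occurrence⇒crossesMax σ x y)) ⟩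
  (anyᵇ (isOccurrence σ x y) u ∨ anyPair (isOccurrence σ x) u) ∨ anyᵇ (crossesMax σ x) v ∎
  where
  open ≡-Reasoning
  rearrange : ∀ p q r c → (q ≡ true → c ≡ true) → ((p ∨ q) ∨ (r ∨ c)) ≡ ((p ∨ r) ∨ c)
  rearrange true q r c _ = refl
  rearrange false false r c _ = refl
  rearrange false true r c q⇒c = sym (trans (cong (r ∨_) (q⇒c refl)) (∨-zeroʳ r))

anyTriple-++-max : (σ : Pattern) {M : ℕ} (u v : List ℕ) → All (_< M) u → All (_< M) v →
  anyTriple (isOccurrence σ) (u ++ M ∷ v)
    ≡ (crossing σ u v ∨ (anyTriple (isOccurrence σ) u ∨ anyTriple (isOccurrence σ) v))
anyTriple-++-max σ [] v [] v<M = cong (_∨ anyTriple (isOccurrence σ) v) (anyPair-max σ v v<M)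
anyTriple-++-max σ (x ∷ u) v (x<M ∷ u<M) v<M =
  trans (cong₂ _∨_ (anyPair-++-max σ u v x<M u<M v<M) (anyTriple-++-max σ u v u<M v<M))
        (rearrange (anyPair (isOccurrence σ x) u) (anyᵇ (crossesMax σ x) v) (crossing σ u v) _ _)
  where
  rearrange : ∀ p c a r o → ((p ∨ c) ∨ (a ∨ (r ∨ o))) ≡ ((c ∨ a) ∨ ((p ∨ r) ∨ o))
  rearrange true c a r o = sym (∨-zeroʳ (c ∨ a))
  rearrange false true a r o = refl
  rearrange false false true r o = refl
  rearrange false false false r o = refl

compatible : Pattern → ℕ → ℕ → Bool
compatible σ x z = not (crossesMax σ x z)

all-not : (f : ℕ → Bool) (v : List ℕ) → all (not ∘ f) v ≡ not (anyᵇ f v)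
all-not f [] = refl
all-not f (z ∷ v) with f z
... | true = refl
... | false = all-not f v

relAll-compatible : (σ : Pattern) (u v : List ℕ) → relAll (compatible σ) u v ≡ not (crossing σ u v)
relAll-compatible σ [] v = refl
relAll-compatible σ (x ∷ u) v rewrite all-not (crossesMax σ x) v | relAll-compatible σ u v with anyᵇ (crossesMax σ x) v
... | true = refl
... | false = refl

avoids-++-max : (σ : Pattern) {M : ℕ} (u v : List ℕ) → All (_< M) u → All (_< M) v →
  avoids σ (u ++ M ∷ v) ≡ (relAll (compatible σ) u v ∧ (avoids σ u ∧ avoids σ v))
avoids-++-max σ {M} u v u<M v<M
  rewrite avoids≡noOccurrence σ (u ++ M ∷ v) | anyTriple-++-max σ u v u<M v<M | relAll-compatible σ u v
        | avoids≡noOccurrence σ u | avoids≡noOccurrence σ v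
  = deMorgan (crossing σ u v) (anyTriple (isOccurrence σ) u) (anyTriple (isOccurrence σ) v)
  where
  deMorgan : ∀ a b c → not (a ∨ (b ∨ c)) ≡ (not a ∧ (not b ∧ not c))
  deMorgan true b c = refl
  deMorgan false true c = refl
  deMorgan false false c = refl

-- First ascents

even-suc : (n : ℕ) → even (suc n) ≡ not (even n)
even-suc zero = refl
even-suc (suc zero) = refl
even-suc (suc (suc n)) = even-suc n

nonempty : List ℕ → Bool
nonempty [] = false
nonempty (_ ∷ _) = true

firstAscent-suc : (i x : ℕ) (w : List ℕ) → firstAscent (suc i) (x ∷ w) ≡ suc (firstAscent i (x ∷ w))
firstAscent-suc i x [] = refl
firstAscent-suc i x (y ∷ w) with x <ᵇ y
... | true = refl
... | false = firstAscent-suc (suc i) y w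

firstAscent-shift : (i x : ℕ) (w : List ℕ) → firstAscent i (suc x ∷ map suc w) ≡ firstAscent i (x ∷ w)
firstAscent-shift i x [] = refl
firstAscent-shift i x (y ∷ w) with x <ᵇ y
... | true = refl
... | false = firstAscent-shift (suc i) y w

isDesarrangement-shift : ShiftInvariant isDesarrangement
isDesarrangement-shift [] = refl
isDesarrangement-shift (x ∷ w) = cong even (firstAscent-shift 1 x w)

isDesarrangement-max-∷ : {M : ℕ} (v : List ℕ) → All (_< M) v →
  isDesarrangement (M ∷ v) ≡ (nonempty v ∧ not (isDesarrangement v))
isDesarrangement-max-∷ [] [] = refl
isDesarrangement-max-∷ (y ∷ v) (y<M ∷ _) rewrite <ᵇ-false (<⇒≤ y<M) | firstAscent-suc 1 y v =
  even-suc (firstAscent 1 (y ∷ v))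

firstAscent-++-max : {M : ℕ} (i x : ℕ) (u v : List ℕ) → All (_< M) (x ∷ u) →
  firstAscent i ((x ∷ u) ++ M ∷ v) ≡ firstAscent i (x ∷ u)
firstAscent-++-max i x [] v (x<M ∷ []) rewrite <ᵇ-true x<M = refl
firstAscent-++-max i x (y ∷ u) v (_ ∷ y∷u<M) with x <ᵇ y
... | true = refl
... | false = firstAscent-++-max (suc i) y u v y∷u<M

isDesarrangement-++-max : {M : ℕ} (x : ℕ) (u v : List ℕ) → All (_< M) (x ∷ u) →
  isDesarrangement ((x ∷ u) ++ M ∷ v) ≡ isDesarrangement (x ∷ u)
isDesarrangement-++-max x u v x∷u<M = cong even (firstAscent-++-max 1 x u v x∷u<M)

-- Decomposition at the maximum

below : ℕ → ℕ → Bool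
below c x = x <ᵇ c

filterᵇ-below-range : (lo c d : ℕ) → filterᵇ (below (lo + c)) (range lo (c + d)) ≡ range lo c
filterᵇ-below-range lo c d = begin
  filterᵇ (below (lo + c)) (range lo (c + d))
    ≡⟨ cong (filterᵇ _) (range-++ lo c d) ⟩
  filterᵇ (below (lo + c)) (range lo c ++ range (lo + c) d)
    ≡⟨ filterᵇ-++ _ (range lo c) _ ⟩
  filterᵇ (below (lo + c)) (range lo c) ++ filterᵇ (below (lo + c)) (range (lo + c) d)
    ≡⟨ cong₂ _++_ (filterᵇ-all _ (range lo c) (λ x∈ → <ᵇ-true (proj₂ (∈-range⁻ lo c x∈))))
                  (filterᵇ-none _ (range (lo + c) d) (λ x∈ → <ᵇ-false (proj₁ (∈-range⁻ (lo + c) d x∈)))) ⟩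
  range lo c ++ []
    ≡⟨ ++-identityʳ (range lo c) ⟩
  range lo c ∎
  where open ≡-Reasoning

filterᵇ-notBelow-range : (lo c d : ℕ) → filterᵇ (not ∘ below (lo + c)) (range lo (c + d)) ≡ range (lo + c) d
filterᵇ-notBelow-range lo c d = begin
  filterᵇ (not ∘ below (lo + c)) (range lo (c + d))
    ≡⟨ cong (filterᵇ _) (range-++ lo c d) ⟩
  filterᵇ (not ∘ below (lo + c)) (range lo c ++ range (lo + c) d)
    ≡⟨ filterᵇ-++ _ (range lo c) _ ⟩
  filterᵇ (not ∘ below (lo + c)) (range lo c) ++ filterᵇ (not ∘ below (lo + c)) (range (lo + c) d)
    ≡⟨ cong₂ _++_ (filterᵇ-none _ (range lo c) (λ x∈ → cong not (<ᵇ-true (proj₂ (∈-range⁻ lo c x∈)))))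
                  (filterᵇ-all _ (range (lo + c) d) (λ x∈ → cong not (<ᵇ-false (proj₁ (∈-range⁻ (lo + c) d x∈))))) ⟩
  range (lo + c) d ∎
  where open ≡-Reasoning

-- In a permutation of [0, m] avoiding 132 (231), the i letters before m are the i largest
-- (smallest) letters of [0, m).
inPrefixBlock : Pattern → ℕ → ℕ → ℕ → Bool
inPrefixBlock p132 m i = not ∘ below (m ∸ i)
inPrefixBlock p231 m i = below i

prefixStart suffixStart : Pattern → ℕ → ℕ → ℕ
prefixStart p132 m i = m ∸ i
prefixStart p231 m i = 0
suffixStart p132 m i = 0
suffixStart p231 m i = i

prefixBlock-range : (σ : Pattern) {m i : ℕ} → i ≤ m →
  filterᵇ (inPrefixBlock σ m i) (range 0 m) ≡ range (prefixStart σ m i) i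
prefixBlock-range p132 {m} {i} i≤m =
  subst (λ n → filterᵇ (not ∘ below (m ∸ i)) (range 0 n) ≡ range (m ∸ i) i) (m∸n+n≡m i≤m) (filterᵇ-notBelow-range 0 (m ∸ i) i)
prefixBlock-range p231 {m} {i} i≤m =
  subst (λ n → filterᵇ (below i) (range 0 n) ≡ range 0 i) (m+[n∸m]≡n i≤m) (filterᵇ-below-range 0 i (m ∸ i))

suffixBlock-range : (σ : Pattern) {m i : ℕ} → i ≤ m →
  filterᵇ (not ∘ inPrefixBlock σ m i) (range 0 m) ≡ range (suffixStart σ m i) (m ∸ i)
suffixBlock-range p132 {m} {i} i≤m =
  trans (filterᵇ-cong (range 0 m) (λ x → not-involutive (below (m ∸ i) x)))
        (subst (λ n → filterᵇ (below (m ∸ i)) (range 0 n) ≡ range 0 (m ∸ i)) (m∸n+n≡m i≤m) (filterᵇ-below-range 0 (m ∸ i) i))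
suffixBlock-range p231 {m} {i} i≤m =
  subst (λ n → filterᵇ (not ∘ below i) (range 0 n) ≡ range i (m ∸ i)) (m+[n∸m]≡n i≤m) (filterᵇ-notBelow-range 0 i (m ∸ i))

blocks-separated : (σ : Pattern) (m i : ℕ) → Separated (inPrefixBlock σ m i) (compatible σ) (range 0 m)
blocks-separated p132 m i {x} {y} _ _ x-high y-low = cong not (<ᵇ-false (<⇒≤ y<x)) , cong not (<ᵇ-true y<x)
  where
  y<x : y < x
  y<x = <-≤-trans (<ᵇ-sound y (m ∸ i) (not-injective y-low))
                  (≮⇒≥ (λ x<c → true≢false (trans (sym x-high) (cong not (<ᵇ-true x<c)))))
blocks-separated p231 m i {x} {y} _ _ x-low y-high = cong not (<ᵇ-false (<⇒≤ x<y)) , cong not (<ᵇ-true x<y)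
  where
  x<y : x < y
  x<y = <-≤-trans (<ᵇ-sound x i x-low) (≮⇒≥ (λ y<c → true≢false (trans (sym (<ᵇ-true y<c)) y-high)))

#perms : (List ℕ → Bool) → ℕ → ℕ
#perms P n = arrangements (range 0 n) n P

arrangements-max-at : (σ : Pattern) (m i : ℕ) (Q P₁ P₂ : List ℕ → Bool) → i ≤ m →
  ShiftInvariant P₁ → ShiftInvariant P₂ →
  (∀ u v → All (_< m) u → All (_< m) v → length u ≡ i →
     Q (u ++ m ∷ v) ≡ (relAll (compatible σ) u v ∧ (P₁ u ∧ P₂ v))) →
  arrangements (range 0 (suc m)) (suc m) (λ w → occursAt m i w ∧ Q w) ≡ #perms P₁ i * #perms P₂ (m ∸ i)
arrangements-max-at σ m i Q P₁ P₂ i≤m P₁-shift P₂-shift Q-split = begin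
  arrangements (range 0 (suc m)) (suc m) (λ w → occursAt m i w ∧ Q w)
    ≡⟨ arrangements-occursAt (range 0 (suc m)) m i m Q (distinct-range 0 (suc m)) (∈-range⁺ 0 (suc m) z≤n (n<1+n m)) i≤m ⟩
  arrangements (remove m (range 0 (suc m))) m (λ w → Q (take i w ++ m ∷ drop i w))
    ≡⟨ cong (λ A → arrangements A m (λ w → Q (take i w ++ m ∷ drop i w))) (remove-range-last 0 m) ⟩
  arrangements (range 0 m) m (λ w → Q (take i w ++ m ∷ drop i w))
    ≡⟨ arrangements-cong (range 0 m) m (λ w |w|≡m w⊆ _ →
         Q-split (take i w) (drop i w) (take⁺ i (below-m w⊆)) (drop⁺ i (below-m w⊆))
                 (trans (length-take i w) (m≤n⇒m⊓n≡m (subst (i ≤_) (sym |w|≡m) i≤m)))) ⟩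
  arrangements (range 0 m) m (splitsAt (compatible σ) i P₁ P₂)
    ≡⟨ cong (λ k → arrangements (range 0 m) k (splitsAt (compatible σ) i P₁ P₂)) (m+[n∸m]≡n i≤m) ⟨
  arrangements (range 0 m) (i + (m ∸ i)) (splitsAt (compatible σ) i P₁ P₂)
    ≡⟨ arrangements-separated (inPrefixBlock σ m i) (compatible σ) (range 0 m) i (m ∸ i) P₁ P₂
         (distinct-range 0 m) (blocks-separated σ m i)
         (trans (cong length (prefixBlock-range σ i≤m)) (length-range _ i))
         (trans (cong length (suffixBlock-range σ i≤m)) (length-range _ (m ∸ i))) ⟩
  arrangements (filterᵇ (inPrefixBlock σ m i) (range 0 m)) i P₁
    * arrangements (filterᵇ (not ∘ inPrefixBlock σ m i) (range 0 m)) (m ∸ i) P₂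
    ≡⟨ cong₂ (λ X Y → arrangements X i P₁ * arrangements Y (m ∸ i) P₂) (prefixBlock-range σ i≤m) (suffixBlock-range σ i≤m) ⟩
  arrangements (range (prefixStart σ m i) i) i P₁ * arrangements (range (suffixStart σ m i) (m ∸ i)) (m ∸ i) P₂
    ≡⟨ cong₂ _*_ (arrangements-range-shift _ i i P₁ P₁-shift) (arrangements-range-shift _ (m ∸ i) (m ∸ i) P₂ P₂-shift) ⟩
  #perms P₁ i * #perms P₂ (m ∸ i) ∎
  where
  open ≡-Reasoning
  below-m : {w : List ℕ} → All (_∈ range 0 m) w → All (_< m) w
  below-m = All.map (λ x∈ → proj₂ (∈-range⁻ 0 m x∈))

#perms-max-decomposition : (σ : Pattern) (m : ℕ) (Q : List ℕ → Bool) (P₁ P₂ : ℕ → List ℕ → Bool) →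
  (∀ i → ShiftInvariant (P₁ i)) → (∀ i → ShiftInvariant (P₂ i)) →
  (∀ {i} → i ≤ m → ∀ u v → All (_< m) u → All (_< m) v → length u ≡ i →
     Q (u ++ m ∷ v) ≡ (relAll (compatible σ) u v ∧ (P₁ i u ∧ P₂ i v))) →
  #perms Q (suc m) ≡ sumBelow (suc m) (λ i → #perms (P₁ i) i * #perms (P₂ i) (m ∸ i))
#perms-max-decomposition σ m Q P₁ P₂ P₁-shift P₂-shift Q-split =
  trans (arrangements-by-position (range 0 (suc m)) (suc m) m Q (∈-range⁺ 0 (suc m) z≤n (n<1+n m)) (length-range 0 (suc m)))
        (sumBelow-cong (suc m) (λ {i} i<1+m → arrangements-max-at σ m i Q (P₁ i) (P₂ i) (≤-pred i<1+m)
                                                  (P₁-shift i) (P₂-shift i) (Q-split (≤-pred i<1+m))))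

desAvoiding : Pattern → List ℕ → Bool
desAvoiding σ w = isDesarrangement w ∧ avoids σ w

oddAvoiding : Pattern → List ℕ → Bool
oddAvoiding σ w = nonempty w ∧ (not (isDesarrangement w) ∧ avoids σ w)

avoids-[] : (σ : Pattern) → avoids σ [] ≡ true
avoids-[] p132 = refl
avoids-[] p231 = refl

desAvoiding-shift : (σ : Pattern) → ShiftInvariant (desAvoiding σ)
desAvoiding-shift σ w = cong₂ _∧_ (isDesarrangement-shift w) (avoids-shift σ w)

oddAvoiding-shift : (σ : Pattern) → ShiftInvariant (oddAvoiding σ)
oddAvoiding-shift σ [] = refl
oddAvoiding-shift σ (x ∷ w) = cong₂ (λ d a → not d ∧ a) (isDesarrangement-shift (x ∷ w)) (avoids-shift σ (x ∷ w))

avoiders-recurrence : (σ : Pattern) (m : ℕ) →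
  #perms (avoids σ) (suc m) ≡ sumBelow (suc m) (λ i → #perms (avoids σ) i * #perms (avoids σ) (m ∸ i))
avoiders-recurrence σ m = #perms-max-decomposition σ m (avoids σ) (λ _ → avoids σ) (λ _ → avoids σ)
  (λ _ → avoids-shift σ) (λ _ → avoids-shift σ) (λ _ u v u<m v<m _ → avoids-++-max σ u v u<m v<m)

desarrangement-recurrence : (σ : Pattern) (m : ℕ) →
  #perms (desAvoiding σ) (suc m)
    ≡ #perms (oddAvoiding σ) m + sumBelow m (λ i → #perms (desAvoiding σ) (suc i) * #perms (avoids σ) (m ∸ suc i))
desarrangement-recurrence σ m =
  trans (#perms-max-decomposition σ m (desAvoiding σ) prefixProperty suffixProperty
           prefixProperty-shift suffixProperty-shift desAvoiding-split)
        (cong (_+ sumBelow m (λ i → #perms (desAvoiding σ) (suc i) * #perms (avoids σ) (m ∸ suc i)))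
              (trans (cong (λ b → (ind b + 0) * #perms (oddAvoiding σ) m) (avoids-[] σ)) (+-identityʳ _)))
  where
  prefixProperty suffixProperty : ℕ → List ℕ → Bool
  prefixProperty zero = avoids σ
  prefixProperty (suc _) = desAvoiding σ
  suffixProperty zero = oddAvoiding σ
  suffixProperty (suc _) = avoids σ

  prefixProperty-shift : ∀ i → ShiftInvariant (prefixProperty i)
  prefixProperty-shift zero = avoids-shift σ
  prefixProperty-shift (suc _) = desAvoiding-shift σ
  suffixProperty-shift : ∀ i → ShiftInvariant (suffixProperty i)
  suffixProperty-shift zero = oddAvoiding-shift σ
  suffixProperty-shift (suc _) = avoids-shift σ

  desAvoiding-split : ∀ {i} → i ≤ m → ∀ u v → All (_< m) u → All (_< m) v → length u ≡ i →
    desAvoiding σ (u ++ m ∷ v) ≡ (relAll (compatible σ) u v ∧ (prefixProperty i u ∧ suffixProperty i v))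
  desAvoiding-split {zero} _ [] v [] v<m _
    rewrite isDesarrangement-max-∷ v v<m | avoids-++-max σ [] v [] v<m | avoids-[] σ =
    ∧-assoc (nonempty v) (not (isDesarrangement v)) (avoids σ v)
  desAvoiding-split {suc i} _ (x ∷ u) v x∷u<m v<m _
    rewrite isDesarrangement-++-max x u v x∷u<m | avoids-++-max σ (x ∷ u) v x∷u<m v<m =
    rearrange (isDesarrangement (x ∷ u)) (relAll (compatible σ) (x ∷ u) v) (avoids σ (x ∷ u)) (avoids σ v)
    where
    rearrange : ∀ d r a b → (d ∧ (r ∧ (a ∧ b))) ≡ (r ∧ ((d ∧ a) ∧ b))
    rearrange true r a b = refl
    rearrange false r a b = sym (∧-zeroʳ r)

avoiders-split : (σ : Pattern) (m : ℕ) →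
  #perms (avoids σ) (suc m) ≡ #perms (desAvoiding σ) (suc m) + #perms (oddAvoiding σ) (suc m)
avoiders-split σ m = trans (arrangements-split (range 0 (suc m)) (suc m) isDesarrangement (avoids σ))
  (cong (#perms (desAvoiding σ) (suc m) +_) (arrangements-cong (range 0 (suc m)) (suc m) nonempty-word))
  where
  nonempty-word : ∀ w → length w ≡ suc m → All (_∈ range 0 (suc m)) w → distinct w ≡ true →
    (not (isDesarrangement w) ∧ avoids σ w) ≡ oddAvoiding σ w
  nonempty-word (_ ∷ _) _ _ _ = refl

length-filter-filter : (p q : List ℕ → Bool) (xs : List (List ℕ)) →
  length (filter (T? ∘ p) (filter (T? ∘ q) xs)) ≡ count (λ w → q w ∧ p w) xs
length-filter-filter p q [] = refl
length-filter-filter p q (x ∷ xs) with q x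
... | false = length-filter-filter p q xs
... | true with p x
...   | true = cong suc (length-filter-filter p q xs)
...   | false = length-filter-filter p q xs

tabulate-toℕ : (n : ℕ) → tabulate {n = n} toℕ ≡ range 0 n
tabulate-toℕ zero = refl
tabulate-toℕ (suc n) = cong (0 ∷_) (begin
  tabulate (suc ∘ toℕ)        ≡⟨ map-tabulate toℕ suc ⟨
  map suc (tabulate toℕ)      ≡⟨ cong (map suc) (tabulate-toℕ n) ⟩
  map suc (range 0 n)         ≡⟨ range-suc 0 n ⟨
  range 1 n                   ∎)
  where open ≡-Reasoning

words≡wordsOver : (n k : ℕ) → words n k ≡ wordsOver (range 0 n) k
words≡wordsOver n zero = refl
words≡wordsOver n (suc k) = begin
  concatMap (λ i → map (toℕ i ∷_) (words n k)) (allFin n)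
    ≡⟨ cong (λ W → concatMap (λ i → map (toℕ i ∷_) W) (allFin n)) (words≡wordsOver n k) ⟩
  concatMap (λ i → map (toℕ i ∷_) (wordsOver (range 0 n) k)) (allFin n)
    ≡⟨ concatMap-map (λ x → map (x ∷_) (wordsOver (range 0 n) k)) toℕ (allFin n) ⟨
  concatMap (λ x → map (x ∷_) (wordsOver (range 0 n) k)) (map toℕ (allFin n))
    ≡⟨ cong (concatMap (λ x → map (x ∷_) (wordsOver (range 0 n) k))) (trans (map-tabulate id toℕ) (tabulate-toℕ n)) ⟩
  concatMap (λ x → map (x ∷_) (wordsOver (range 0 n) k)) (range 0 n) ∎
  where open ≡-Reasoning

d≡#perms : (n : ℕ) (σ : Pattern) → d n σ ≡ #perms (desAvoiding σ) n
d≡#perms n σ = trans (length-filter-filter (desAvoiding σ) distinct (words n n))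
                     (cong (count (λ w → distinct w ∧ desAvoiding σ w)) (words≡wordsOver n n))

-- ℤ is opened only here, since its prefix +_ makes sections such as (n +_) above ambiguous.
open FineNumbers using (sumℤ; sumℤ-cong; catalan-suc; fine-desarrangement-recurrence)
open import Data.Integer as ℤ using (ℤ; +_)
open import Data.Integer.Properties using (pos-+; pos-*)
open import Data.Integer.Tactic.RingSolver using (solve-∀)

+-sumBelow : (k : ℕ) (g : ℕ → ℕ) → + sumBelow k g ≡ sumℤ k (+_ ∘ g)
+-sumBelow zero g = refl
+-sumBelow (suc k) g = trans (pos-+ (g 0) _) (cong (ℤ._+_ (+ g 0)) (+-sumBelow k (g ∘ suc)))

pos-difference : {a b c : ℕ} → a ≡ b + c → + c ≡ + a ℤ.- + b
pos-difference {b = b} {c} refl rewrite pos-+ b c = ℤ-cancel (+ b) (+ c)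
  where
  ℤ-cancel : ∀ x y → y ≡ (x ℤ.+ y) ℤ.- x
  ℤ-cancel = solve-∀

avoiders-catalan : (σ : Pattern) (n : ℕ) → + #perms (avoids σ) n ≡ catalan n
avoiders-catalan σ = <-rec (λ n → + #perms (avoids σ) n ≡ catalan n) step
  where
  A : ℕ → ℕ
  A = #perms (avoids σ)
  step : ∀ n → (∀ {j} → j < n → + A j ≡ catalan j) → + A n ≡ catalan n
  step zero _ = cong (λ b → + (ind b + 0)) (avoids-[] σ)
  step (suc m) IH = begin
    + A (suc m)                                              ≡⟨ cong +_ (avoiders-recurrence σ m) ⟩
    + sumBelow (suc m) (λ i → A i * A (m ∸ i))               ≡⟨ +-sumBelow (suc m) (λ i → A i * A (m ∸ i)) ⟩
    sumℤ (suc m) (λ i → + (A i * A (m ∸ i)))                 ≡⟨ sumℤ-cong (suc m) (λ {i} i<1+m →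
                                                                  trans (pos-* (A i) (A (m ∸ i)))
                                                                        (cong₂ ℤ._*_ (IH i<1+m) (IH (s≤s (m∸n≤m m i))))) ⟩
    sumℤ (suc m) (λ i → catalan i ℤ.* catalan (m ∸ i))       ≡⟨ catalan-suc m ⟨
    catalan (suc m)                                          ∎
    where open ≡-Reasoning

desarrangements-fine : (σ : Pattern) (n : ℕ) → + #perms (desAvoiding σ) (suc n) ≡ fine (2 + n)
desarrangements-fine σ = <-rec (λ n → + D (suc n) ≡ fine (2 + n)) step
  where
  D A O : ℕ → ℕ
  D = #perms (desAvoiding σ)
  A = #perms (avoids σ)
  O = #perms (oddAvoiding σ)
  step : ∀ n → (∀ {j} → j < n → + D (suc j) ≡ fine (2 + j)) → + D (suc n) ≡ fine (2 + n)
  step zero _ = cong +_ (desarrangement-recurrence σ 0)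
  step (suc m) IH = begin
    + D (2 + m)
      ≡⟨ cong +_ (desarrangement-recurrence σ (suc m)) ⟩
    + (O (suc m) + sumBelow (suc m) (λ i → D (suc i) * A (m ∸ i)))
      ≡⟨ pos-+ (O (suc m)) _ ⟩
    + O (suc m) ℤ.+ + sumBelow (suc m) (λ i → D (suc i) * A (m ∸ i))
      ≡⟨ cong₂ ℤ._+_ odd (+-sumBelow (suc m) (λ i → D (suc i) * A (m ∸ i))) ⟩
    (catalan (suc m) ℤ.- fine (2 + m)) ℤ.+ sumℤ (suc m) (λ i → + (D (suc i) * A (m ∸ i)))
      ≡⟨ cong (ℤ._+_ (catalan (suc m) ℤ.- fine (2 + m))) (sumℤ-cong (suc m) (λ {i} i<1+m →
           trans (pos-* (D (suc i)) (A (m ∸ i))) (cong₂ ℤ._*_ (IH i<1+m) (avoiders-catalan σ (m ∸ i))))) ⟩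
    (catalan (suc m) ℤ.- fine (2 + m)) ℤ.+ sumℤ (suc m) (λ i → fine (2 + i) ℤ.* catalan (m ∸ i))
      ≡⟨ fine-desarrangement-recurrence m ⟨
    fine (3 + m) ∎
    where
    open ≡-Reasoning
    odd : + O (suc m) ≡ catalan (suc m) ℤ.- fine (2 + m)
    odd = trans (pos-difference (avoiders-split σ m)) (cong₂ ℤ._-_ (avoiders-catalan σ (suc m)) (IH (n<1+n m)))

theorem3p8 : (n : ℕ) → n ≥ 2 → (σ : Pattern) → + (d n σ) ≡ fine (suc n)
theorem3p8 (suc (suc k)) (s≤s (s≤s z≤n)) σ = begin
  + d (2 + k) σ                          ≡⟨ cong +_ (d≡#perms (2 + k) σ) ⟩
  + #perms (desAvoiding σ) (2 + k)       ≡⟨ desarrangements-fine σ (suc k) ⟩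
  fine (3 + k)                           ∎
  where open ≡-Reasoning
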